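{- Let $\mathcal{R}$ be a commutative ring with identity equipped with an involutive ring automorphism $*$, and let $\mathcal{T}\subseteq\mathcal{R}\setminus\{0\}$ be a multiplicatively closed subset with $-1\in\mathcal{T}$ and $\mathcal{T}^*=\mathcal{T}$. Let $m,n$ be positive integers and suppose $\mathbf{a},\mathbf{b}\in\mathcal{T}^{n+1}$, $\mathbf{c},\mathbf{d}\in\mathcal{T}^{n}$, $\mathbf{f},\mathbf{g}\in\mathcal{T}^{m+1}$, $\mathbf{h},\mathbf{e}\in\mathcal{T}^{m}$ satisfy \begin{align*} \phi_{\mathbf{a}}\phi_{\mathbf{a}}^*+\phi_{\mathbf{b}}\phi_{\mathbf{b}}^*+\phi_{\mathbf{c}}\phi_{\mathbf{c}}^*+\phi_{\mathbf{d}}\phi_{\mathbf{d}}^*&=2(2n+1),\\ \phi_{\mathbf{e}}\phi_{\mathbf{e}}^*+\phi_{\mathbf{f}}\phi_{\mathbf{f}}^*+\phi_{\mathbf{g}}\phi_{\mathbf{g}}^*+\phi_{\mathbf{h}}\phi_{\mathbf{h}}^*&=2(2m+1) \end{align*} in $\mathcal{R}[x^{\pm1}]$. Then there exist $\mathbf{q},\mathbf{r},\mathbf{s},\mathbf{t}\in\mathcal{T}^{(2m+1)(2n+1)}$ such that \[ \phi_{\mathbf{q}}\phi_{\mathbf{q}}^*+\phi_{\mathbf{r}}\phi_{\mathbf{r}}^*+\phi_{\mathbf{s}}\phi_{\mathbf{s}}^*+\phi_{\mathbf{t}}\phi_{\mathbf{t}}^*=4(2m+1)(2n+1). \]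
   Context: For $\mathbf{s}=(s_0,\dots,s_{k-1})\in\mathcal{R}^k$, the Hall polynomial is $\phi_{\mathbf{s}}(x)=\sum_{i=0}^{k-1}s_ix^i\in\mathcal{R}[x^{\pm1}]$. The involution $*$ is extended to $\mathcal{R}[x^{\pm1}]$ by applying $*$ to coefficients and sending $x\mapsto x^{ -1}$; $p^*$ denotes the image of $p$. $\mathcal{T}^k$ denotes sequences of length $k$ all of whose entries lie in $\mathcal{T}$. (Equivalently, each condition may be stated with $\psi_{\mathbf{s}}(x)=x^{1-k}\phi_{\mathbf{s}}(x^2)$ in place of $\phi_{\mathbf{s}}$, since $\psi_{\mathbf{s}}\psi_{\mathbf{s}}^*(x)=\phi_{\mathbf{s}}\phi_{\mathbf{s}}^*(x^2)$.) -}

module Defs where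

open import Level using (Level; _⊔_)
open import Data.Nat using (ℕ; zero; suc; _∸_)
open import Data.Integer as ℤ using (ℤ; +_; -[1+_]; _⊓_; ∣_∣)
open import Data.List as List using (List; []; _∷_; map; reverse; replicate; _++_; length)
open import Data.Vec as Vec using (Vec)
open import Relation.Nullary using (¬_)
open import Algebra.Bundles using (CommutativeRing)
open import Algebra.Morphism.Structures using (module RingMorphisms)

-- An involutive ring automorphism ⋆ of R: a (unital) ring endomorphism with
-- ⋆ (⋆ x) ≈ x (hence bijective, so an automorphism).
record IsInvolutiveAutomorphism {c ℓ : Level} (R : CommutativeRing c ℓ)
    (⋆ : CommutativeRing.Carrier R → CommutativeRing.Carrier R) : Set (c ⊔ ℓ) where
  open CommutativeRing R
  field
    isRingHomomorphism : RingMorphisms.IsRingHomomorphism rawRing rawRing ⋆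
    involutive : ∀ x → ⋆ (⋆ x) ≈ x

-- T ⊆ R \ {0}, multiplicatively closed, -1 ∈ T, T* = T.
-- T is a subset of the setoid carrier, hence closed under ≈.
-- Since ⋆ is involutive, T* = T is equivalent to T* ⊆ T (star-closed).
record IsAdmissibleSubset {c ℓ t : Level} (R : CommutativeRing c ℓ)
    (⋆ : CommutativeRing.Carrier R → CommutativeRing.Carrier R)
    (T : CommutativeRing.Carrier R → Set t) : Set (c ⊔ ℓ ⊔ t) where
  open CommutativeRing R
  field
    respects : ∀ {x y} → x ≈ y → T x → T y
    nonzero : ∀ {x} → T x → ¬ (x ≈ 0#)
    mult-closed : ∀ {x y} → T x → T y → T (x * y)
    minus-one : T (- 1#)
    star-closed : ∀ {x} → T x → T (⋆ x)

-- Laurent polynomials over R:  (o , [c₀,…,c_{k-1}])  represents  x^o (c₀ + c₁x + … ).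
module LaurentPoly {c ℓ : Level} (R : CommutativeRing c ℓ)
    (⋆ : CommutativeRing.Carrier R → CommutativeRing.Carrier R) where
  open CommutativeRing R

  record Laurent : Set c where
    constructor mkL
    field
      off : ℤ
      cs : List Carrier
  open Laurent public

  addList : List Carrier → List Carrier → List Carrier
  addList [] q = q
  addList (a ∷ p) [] = a ∷ p
  addList (a ∷ p) (b ∷ q) = (a + b) ∷ addList p q

  mulList : List Carrier → List Carrier → List Carrier
  mulList [] q = []
  mulList (a ∷ p) q = addList (map (a *_) q) (0# ∷ mulList p q)

  nth : List Carrier → ℕ → Carrier
  nth [] _ = 0#
  nth (a ∷ p) zero = a
  nth (a ∷ p) (suc k) = nth p k

  coeff : Laurent → ℤ → Carrier
  coeff (mkL o l) j with j ℤ.- o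
  ... | + k = nth l k
  ... | -[1+ _ ] = 0#

  shiftTo : ℤ → Laurent → List Carrier
  shiftTo o (mkL o' l) = replicate ∣ o' ℤ.- o ∣ 0# ++ l

  _+L_ : Laurent → Laurent → Laurent
  p +L q = mkL o (addList (shiftTo o p) (shiftTo o q))
    where o = off p ⊓ off q

  _*L_ : Laurent → Laurent → Laurent
  mkL o l *L mkL o' l' = mkL (o ℤ.+ o') (mulList l l')

  -- p* : apply ⋆ to coefficients and send x ↦ x⁻¹
  starL : Laurent → Laurent
  starL (mkL o l) = mkL (ℤ.- (o ℤ.+ + (length l ∸ 1))) (reverse (map ⋆ l))

  _≈L_ : Laurent → Laurent → Set ℓ
  p ≈L q = ∀ j → coeff p j ≈ coeff q j

  fromℕR : ℕ → Carrier
  fromℕR zero = 0#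
  fromℕR (suc k) = 1# + fromℕR k

  constL : ℕ → Laurent
  constL k = mkL (+ 0) (fromℕR k ∷ [])

  φ : ∀ {k} → Vec Carrier k → Laurent
  φ s = mkL (+ 0) (Vec.toList s)

  N : ∀ {k} → Vec Carrier k → Laurent
  N s = φ s *L starL (φ s)

module Submission where

-- With  bar s = reverse (map ⋆ s)  one has x^(k-1) φ_s φ_s* = φ_s φ_(bar s) for s
-- of length k, so the Laurent hypotheses become identities of polynomials over R
-- (coefficient lists):  a·ā + b·b̄ + x(c·c̄ + d·d̄) = 2(2n+1) xⁿ,  and likewise for
-- (f,g,e,h); the conclusion becomes  Σ q·q̄ = 4(2m+1)(2n+1) x^(L-1).  Coefficient
-- lists form a commutative ring R[X] in which substitution p ↦ p(V) is a
-- homomorphism, and interleaving resp. concatenating rows of length N are the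
-- substitutions x ↦ x² resp. x ↦ x^N.  Each output sequence (`product`) is a
-- concatenation of interleaved scaled inputs, so its polynomial is a bilinear
-- `block` in the substituted inputs, and the ring identity `normProduct` adds the
-- four norms up to the product of the two hypothesis norms.

open import Defs
open import Level using (Level; _⊔_)
open import Function using (_∘_; id)
open import Data.Nat as ℕ using (ℕ; zero; suc; _∸_; _≥_)
import Data.Nat.Properties as ℕP
import Data.Nat.Tactic.RingSolver as ℕRing
open import Data.Integer as ℤ using (ℤ; +_; -[1+_]; ∣_∣; _⊓_)
import Data.Integer.Properties as ℤP
import Data.Integer.Tactic.RingSolver as ℤRing
open import Data.List using (List; []; _∷_; map; zipWith; length; _++_; concat; reverse; replicate)
open import Data.List.Properties
  using (unfold-reverse; reverse-++; length-reverse; reverse-map; map-∘; reverse-involutive; length-map; map-id;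
         length-++; concat-map; concat-++; ++-identityʳ; ++-assoc; length-zipWith; map-zipWith)
import Data.List.Relation.Unary.All as ListAll
open ListAll using ([]; _∷_)
open import Data.List.Relation.Unary.All.Properties using (++⁺; concat⁺; map⁺)
open import Data.Vec as Vec using (Vec)
open import Data.Vec.Properties using (length-toList; toList∘fromList; toList-cast)
open import Data.Vec.Relation.Unary.All using (All)
import Data.Vec.Relation.Unary.All.Properties as VecAll
open import Data.Product using (Σ-syntax; _×_; _,_)
open import Algebra.Bundles using (CommutativeRing; CommutativeSemiring)
open import Algebra.Structures using (IsCommutativeRing)
open import Algebra.Morphism.Structures using (module RingMorphisms)
open import Relation.Binary.PropositionalEquality as ≡ using (_≡_)
import Algebra.Solver.Ring.NaturalCoefficients.Default as NatSolver
import Algebra.Properties.Ring as RingProperties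
import Relation.Binary.Reasoning.Setoid as SetoidReasoning

interleave : ∀ {a} {A : Set a} → List A → List A → List A
interleave (u ∷ us) (v ∷ vs) = u ∷ v ∷ interleave us vs
interleave us [] = us
interleave [] (v ∷ vs) = v ∷ vs

map-interleave : ∀ {a b} {A : Set a} {B : Set b} (f : A → B) us vs →
  map f (interleave us vs) ≡ interleave (map f us) (map f vs)
map-interleave f (u ∷ us) (v ∷ vs) = ≡.cong (λ t → f u ∷ f v ∷ t) (map-interleave f us vs)
map-interleave f [] [] = ≡.refl
map-interleave f (u ∷ us) [] = ≡.refl
map-interleave f [] (v ∷ vs) = ≡.refl

module _ {a} {A : Set a} where

  interleave-snoc : ∀ (us vs : List A) x y → length us ≡ suc (length vs) →
    interleave (us ++ x ∷ []) (vs ++ y ∷ []) ≡ interleave us vs ++ y ∷ x ∷ []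
  interleave-snoc (u ∷ []) [] x y eq = ≡.refl
  interleave-snoc (u ∷ u' ∷ us) [] x y ()
  interleave-snoc (u ∷ us) (v ∷ vs) x y eq =
    ≡.cong (λ t → u ∷ v ∷ t) (interleave-snoc us vs x y (ℕP.suc-injective eq))

  reverse-interleave : ∀ (us vs : List A) → length us ≡ suc (length vs) →
    reverse (interleave us vs) ≡ interleave (reverse us) (reverse vs)
  reverse-interleave (u ∷ []) [] eq = ≡.refl
  reverse-interleave (u ∷ u' ∷ us) [] ()
  reverse-interleave (u ∷ us) (v ∷ vs) eq = begin
    reverse (u ∷ v ∷ interleave us vs)                  ≡⟨ unfold-reverse u (v ∷ interleave us vs) ⟩
    reverse (v ∷ interleave us vs) ++ u ∷ []            ≡⟨ ≡.cong (_++ u ∷ []) (unfold-reverse v (interleave us vs)) ⟩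
    (reverse (interleave us vs) ++ v ∷ []) ++ u ∷ []    ≡⟨ ++-assoc (reverse (interleave us vs)) (v ∷ []) (u ∷ []) ⟩
    reverse (interleave us vs) ++ v ∷ u ∷ []            ≡⟨ ≡.cong (_++ v ∷ u ∷ []) (reverse-interleave us vs eq′) ⟩
    interleave (reverse us) (reverse vs) ++ v ∷ u ∷ []  ≡⟨ ≡.sym (interleave-snoc (reverse us) (reverse vs) u v lengths) ⟩
    interleave (reverse us ++ u ∷ []) (reverse vs ++ v ∷ [])
      ≡⟨ ≡.cong₂ interleave (≡.sym (unfold-reverse u us)) (≡.sym (unfold-reverse v vs)) ⟩
    interleave (reverse (u ∷ us)) (reverse (v ∷ vs))    ∎
    where
    open ≡.≡-Reasoning
    eq′ : length us ≡ suc (length vs)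
    eq′ = ℕP.suc-injective eq
    lengths : length (reverse us) ≡ suc (length (reverse vs))
    lengths = ≡.trans (length-reverse us) (≡.trans eq′ (≡.cong suc (≡.sym (length-reverse vs))))

  length-interleave : ∀ (us vs : List A) → length (interleave us vs) ≡ length us ℕ.+ length vs
  length-interleave (u ∷ us) (v ∷ vs) =
    ≡.cong suc (≡.trans (≡.cong suc (length-interleave us vs)) (≡.sym (ℕP.+-suc (length us) (length vs))))
  length-interleave [] [] = ≡.refl
  length-interleave (u ∷ us) [] = ≡.sym (ℕP.+-identityʳ (length (u ∷ us)))
  length-interleave [] (v ∷ vs) = ≡.refl

  All-interleave : ∀ {p} {P : A → Set p} {us vs} → ListAll.All P us → ListAll.All P vs → ListAll.All P (interleave us vs)
  All-interleave (pu ∷ pus) (pv ∷ pvs) = pu ∷ pv ∷ All-interleave pus pvs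
  All-interleave [] [] = []
  All-interleave (pu ∷ pus) [] = pu ∷ pus
  All-interleave [] (pv ∷ pvs) = pv ∷ pvs

  All-reverse : ∀ {p} {P : A → Set p} {us} → ListAll.All P us → ListAll.All P (reverse us)
  All-reverse {us = []} [] = []
  All-reverse {P = P} {us = u ∷ us} (pu ∷ pus) =
    ≡.subst (ListAll.All P) (≡.sym (unfold-reverse u us)) (++⁺ (All-reverse pus) (pu ∷ []))

  length-concat : ∀ N (rows : List (List A)) → ListAll.All (λ r → length r ≡ N) rows →
    length (concat rows) ≡ length rows ℕ.* N
  length-concat N [] [] = ≡.refl
  length-concat N (r ∷ rows) (l ∷ ls) = ≡.trans (length-++ r) (≡.cong₂ ℕ._+_ l (length-concat N rows ls))

  reverse-concat : ∀ (rows : List (List A)) → reverse (concat rows) ≡ concat (reverse (map reverse rows))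
  reverse-concat [] = ≡.refl
  reverse-concat (r ∷ rows) = begin
    reverse (r ++ concat rows)                            ≡⟨ reverse-++ r (concat rows) ⟩
    reverse (concat rows) ++ reverse r                    ≡⟨ ≡.cong (_++ reverse r) (reverse-concat rows) ⟩
    concat (reverse (map reverse rows)) ++ reverse r
      ≡⟨ ≡.cong (concat (reverse (map reverse rows)) ++_) (≡.sym (++-identityʳ (reverse r))) ⟩
    concat (reverse (map reverse rows)) ++ concat (reverse r ∷ [])
      ≡⟨ concat-++ (reverse (map reverse rows)) (reverse r ∷ []) ⟩
    concat (reverse (map reverse rows) ++ reverse r ∷ [])
      ≡⟨ ≡.cong concat (≡.sym (unfold-reverse (reverse r) (map reverse rows))) ⟩
    concat (reverse (map reverse (r ∷ rows)))             ∎
    where open ≡.≡-Reasoning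

module _ {a b} {A : Set a} {B : Set b} where

  length-zipWith-≡ : ∀ (f : A → A → B) xs ys → length xs ≡ length ys → length (zipWith f xs ys) ≡ length xs
  length-zipWith-≡ f xs ys eq =
    ≡.trans (length-zipWith f xs ys) (≡.trans (≡.cong (length xs ℕ.⊓_) (≡.sym eq)) (ℕP.⊓-idem (length xs)))

  zipWith-snoc : ∀ (f : A → A → B) xs ys x y → length xs ≡ length ys →
    zipWith f (xs ++ x ∷ []) (ys ++ y ∷ []) ≡ zipWith f xs ys ++ f x y ∷ []
  zipWith-snoc f [] [] x y eq = ≡.refl
  zipWith-snoc f (x′ ∷ xs) (y′ ∷ ys) x y eq = ≡.cong (f x′ y′ ∷_) (zipWith-snoc f xs ys x y (ℕP.suc-injective eq))

  reverse-zipWith : ∀ (f : A → A → B) xs ys → length xs ≡ length ys →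
    reverse (zipWith f xs ys) ≡ zipWith f (reverse xs) (reverse ys)
  reverse-zipWith f [] [] eq = ≡.refl
  reverse-zipWith f (x ∷ xs) (y ∷ ys) eq = begin
    reverse (f x y ∷ zipWith f xs ys)                    ≡⟨ unfold-reverse (f x y) (zipWith f xs ys) ⟩
    reverse (zipWith f xs ys) ++ f x y ∷ []              ≡⟨ ≡.cong (_++ f x y ∷ []) (reverse-zipWith f xs ys eq′) ⟩
    zipWith f (reverse xs) (reverse ys) ++ f x y ∷ []    ≡⟨ ≡.sym (zipWith-snoc f (reverse xs) (reverse ys) x y lengths) ⟩
    zipWith f (reverse xs ++ x ∷ []) (reverse ys ++ y ∷ [])
      ≡⟨ ≡.cong₂ (zipWith f) (≡.sym (unfold-reverse x xs)) (≡.sym (unfold-reverse y ys)) ⟩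
    zipWith f (reverse (x ∷ xs)) (reverse (y ∷ ys))      ∎
    where
    open ≡.≡-Reasoning
    eq′ = ℕP.suc-injective eq
    lengths = ≡.trans (length-reverse xs) (≡.trans eq′ (≡.sym (length-reverse ys)))

  All-zipWith : ∀ {p r} {P : A → Set p} {R : B → Set r} (f : A → A → B) {xs ys} →
    (∀ {x y} → P x → P y → R (f x y)) → ListAll.All P xs → ListAll.All P ys → ListAll.All R (zipWith f xs ys)
  All-zipWith f h (px ∷ pxs) (py ∷ pys) = h px py ∷ All-zipWith f h pxs pys
  All-zipWith f h [] _ = []
  All-zipWith f h (px ∷ pxs) [] = []

asVec : ∀ {a} {A : Set a} {k} (l : List A) → length l ≡ k → Σ[ v ∈ Vec A k ] Vec.toList v ≡ l
asVec l eq = Vec.cast eq (Vec.fromList l) , ≡.trans (toList-cast eq (Vec.fromList l)) (toList∘fromList l)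

module Horner {c ℓ} (S : CommutativeRing c ℓ) where
  open CommutativeRing S
  open NatSolver commutativeSemiring
  open SetoidReasoning setoid

  horner : Carrier → List Carrier → Carrier
  horner w [] = 0#
  horner w (r ∷ rs) = r + w * horner w rs

  horner-interleave : ∀ w us vs → length us ≡ suc (length vs) →
    horner w (interleave us vs) ≈ horner (w * w) us + w * horner (w * w) vs
  horner-interleave w (u ∷ []) [] eq = solve 2 (λ u w → u :+ w :* con 0 := (u :+ (w :* w) :* con 0) :+ w :* con 0) refl u w
  horner-interleave w (u ∷ u′ ∷ us) [] ()
  horner-interleave w (u ∷ us) (v ∷ vs) eq = begin
    u + w * (v + w * horner w (interleave us vs))
      ≈⟨ +-congˡ (*-congˡ (+-congˡ (*-congˡ (horner-interleave w us vs (ℕP.suc-injective eq))))) ⟩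
    u + w * (v + w * (horner (w * w) us + w * horner (w * w) vs))
      ≈⟨ solve 5 (λ u v w a b → u :+ w :* (v :+ w :* (a :+ w :* b)) := (u :+ (w :* w) :* a) :+ w :* (v :+ (w :* w) :* b)) refl u v w _ _ ⟩
    (u + (w * w) * horner (w * w) us) + w * (v + (w * w) * horner (w * w) vs) ∎

  horner-zipWith : ∀ {a} {A : Set a} (h : A → A → Carrier) (g : A → Carrier) α β w (ys ys′ : List A) →
    length ys ≡ length ys′ → (∀ y y′ → h y y′ ≈ g y * α + g y′ * β) →
    horner w (zipWith h ys ys′) ≈ horner w (map g ys) * α + horner w (map g ys′) * β
  horner-zipWith h g α β w [] [] eq H = solve 2 (λ α β → con 0 := con 0 :* α :+ con 0 :* β) refl α β
  horner-zipWith h g α β w (y ∷ ys) (y′ ∷ ys′) eq H = begin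
    h y y′ + w * horner w (zipWith h ys ys′)
      ≈⟨ +-cong (H y y′) (*-congˡ (horner-zipWith h g α β w ys ys′ (ℕP.suc-injective eq) H)) ⟩
    (g y * α + g y′ * β) + w * (horner w (map g ys) * α + horner w (map g ys′) * β)
      ≈⟨ solve 7 (λ a b c d w α β → (a :* α :+ b :* β) :+ w :* (c :* α :+ d :* β) := (a :+ w :* c) :* α :+ (b :+ w :* d) :* β) refl _ _ _ _ w α β ⟩
    (g y + w * horner w (map g ys)) * α + (g y′ + w * horner w (map g ys′)) * β ∎

-- The norm-multiplication identity behind the construction.  `block x w …` is
-- the polynomial of a product sequence (see `product` below): rows indexed by
-- y00,y01 (even) and y10,y11 (odd) interleave scaled copies of the x's, with x
-- the row variable and w = x^N counting rows.  The semiring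
-- solver cannot handle negation, so the identity is first proved with a formal
-- sign ν, separating the part free of ν, the ν² part and the ν part.
module NormProductSigned {c ℓ} (S : CommutativeSemiring c ℓ) where
  open CommutativeSemiring S
  open NatSolver S

  block : Carrier → Carrier → Carrier → Carrier → Carrier → Carrier → Carrier → Carrier → Carrier → Carrier → Carrier
  block x w y00 x00 y01 x01 y10 x10 y11 x11 = (y00 * x00 + y01 * (x * x01)) + w * (y10 * x10 + y11 * (x * x11))

  expand-signed : ∀ a a′ b b′ c c′ d d′ f f′ g g′ e e′ h h′ x w ν →
    let P1 = f * a ; M1 = x * g′ * c + w * e′ * b + w * x * h * d′
        P1′ = f′ * a′ ; M1′ = x * g * c′ + w * e * b′ + w * x * h′ * d
        P2 = f′ * b + w * e * a + w * x * h * c′ ; M2 = x * g′ * d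
        P2′ = f * b′ + w * e′ * a′ + w * x * h′ * c ; M2′ = x * g * d′
        P3 = g * a + x * f′ * c + w * x * e′ * d ; M3 = w * h * b′
        P3′ = g′ * a′ + x * f * c′ + w * x * e * d′ ; M3′ = w * h′ * b
        P4 = g * b + x * f * d + w * h * a′ ; M4 = w * x * e * c
        P4′ = g′ * b′ + x * f′ * d′ + w * h′ * a ; M4′ = w * x * e′ * c′
    in block x w f a g′ (ν * c) e′ (ν * b) h (ν * d′) * block x w f′ a′ g (ν * c′) e (ν * b′) h′ (ν * d)
     + block x w f′ b g′ (ν * d) e a h c′ * block x w f b′ g (ν * d′) e′ a′ h′ c
     + block x w g a f′ c h (ν * b′) e′ d * block x w g′ a′ f c′ h′ (ν * b) e d′
     + block x w g b f d h a′ e (ν * c) * block x w g′ b′ f′ d′ h′ a e′ (ν * c′)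
     ≈ ((P1 * P1′ + P2 * P2′ + P3 * P3′ + P4 * P4′) + ν * ν * (M1 * M1′ + M2 * M2′ + M3 * M3′ + M4 * M4′))
       + ν * ((P1 * M1′ + M1 * P1′) + (P2 * M2′ + M2 * P2′) + (P3 * M3′ + M3 * P3′) + (P4 * M4′ + M4 * P4′))
  expand-signed = solve 19 (λ a a′ b b′ c c′ d d′ f f′ g g′ e e′ h h′ x w ν →
    let P1 = f :* a ; M1 = x :* g′ :* c :+ w :* e′ :* b :+ w :* x :* h :* d′
        P1′ = f′ :* a′ ; M1′ = x :* g :* c′ :+ w :* e :* b′ :+ w :* x :* h′ :* d
        P2 = f′ :* b :+ w :* e :* a :+ w :* x :* h :* c′ ; M2 = x :* g′ :* d
        P2′ = f :* b′ :+ w :* e′ :* a′ :+ w :* x :* h′ :* c ; M2′ = x :* g :* d′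
        P3 = g :* a :+ x :* f′ :* c :+ w :* x :* e′ :* d ; M3 = w :* h :* b′
        P3′ = g′ :* a′ :+ x :* f :* c′ :+ w :* x :* e :* d′ ; M3′ = w :* h′ :* b
        P4 = g :* b :+ x :* f :* d :+ w :* h :* a′ ; M4 = w :* x :* e :* c
        P4′ = g′ :* b′ :+ x :* f′ :* d′ :+ w :* h′ :* a ; M4′ = w :* x :* e′ :* c′
        B′ = λ y00 x00 y01 x01 y10 x10 y11 x11 → (y00 :* x00 :+ y01 :* (x :* x01)) :+ w :* (y10 :* x10 :+ y11 :* (x :* x11))
    in B′ f a g′ (ν :* c) e′ (ν :* b) h (ν :* d′) :* B′ f′ a′ g (ν :* c′) e (ν :* b′) h′ (ν :* d)
     :+ B′ f′ b g′ (ν :* d) e a h c′ :* B′ f b′ g (ν :* d′) e′ a′ h′ c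
     :+ B′ g a f′ c h (ν :* b′) e′ d :* B′ g′ a′ f c′ h′ (ν :* b) e d′
     :+ B′ g b f d h a′ e (ν :* c) :* B′ g′ b′ f′ d′ h′ a e′ (ν :* c′)
     := ((P1 :* P1′ :+ P2 :* P2′ :+ P3 :* P3′ :+ P4 :* P4′) :+ ν :* ν :* (M1 :* M1′ :+ M2 :* M2′ :+ M3 :* M3′ :+ M4 :* M4′))
       :+ ν :* ((P1 :* M1′ :+ M1 :* P1′) :+ (P2 :* M2′ :+ M2 :* P2′) :+ (P3 :* M3′ :+ M3 :* P3′) :+ (P4 :* M4′ :+ M4 :* P4′))) refl

  -- with ν² = 1 and ν = -1 the mixed terms cancel against those of H₁H₂
  cross-terms : ∀ a a′ b b′ c c′ d d′ f f′ g g′ e e′ h h′ x w →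
    let P1 = f * a ; M1 = x * g′ * c + w * e′ * b + w * x * h * d′
        P1′ = f′ * a′ ; M1′ = x * g * c′ + w * e * b′ + w * x * h′ * d
        P2 = f′ * b + w * e * a + w * x * h * c′ ; M2 = x * g′ * d
        P2′ = f * b′ + w * e′ * a′ + w * x * h′ * c ; M2′ = x * g * d′
        P3 = g * a + x * f′ * c + w * x * e′ * d ; M3 = w * h * b′
        P3′ = g′ * a′ + x * f * c′ + w * x * e * d′ ; M3′ = w * h′ * b
        P4 = g * b + x * f * d + w * h * a′ ; M4 = w * x * e * c
        P4′ = g′ * b′ + x * f′ * d′ + w * h′ * a ; M4′ = w * x * e′ * c′
        H1 = a * a′ + b * b′ + x * x * (c * c′ + d * d′)
        H2 = f * f′ + g * g′ + w * w * (e * e′ + h * h′)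
    in (P1 * P1′ + P2 * P2′ + P3 * P3′ + P4 * P4′) + (M1 * M1′ + M2 * M2′ + M3 * M3′ + M4 * M4′)
       ≈ H1 * H2 + ((P1 * M1′ + M1 * P1′) + (P2 * M2′ + M2 * P2′) + (P3 * M3′ + M3 * P3′) + (P4 * M4′ + M4 * P4′))
  cross-terms = solve 18 (λ a a′ b b′ c c′ d d′ f f′ g g′ e e′ h h′ x w →
    let P1 = f :* a ; M1 = x :* g′ :* c :+ w :* e′ :* b :+ w :* x :* h :* d′
        P1′ = f′ :* a′ ; M1′ = x :* g :* c′ :+ w :* e :* b′ :+ w :* x :* h′ :* d
        P2 = f′ :* b :+ w :* e :* a :+ w :* x :* h :* c′ ; M2 = x :* g′ :* d
        P2′ = f :* b′ :+ w :* e′ :* a′ :+ w :* x :* h′ :* c ; M2′ = x :* g :* d′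
        P3 = g :* a :+ x :* f′ :* c :+ w :* x :* e′ :* d ; M3 = w :* h :* b′
        P3′ = g′ :* a′ :+ x :* f :* c′ :+ w :* x :* e :* d′ ; M3′ = w :* h′ :* b
        P4 = g :* b :+ x :* f :* d :+ w :* h :* a′ ; M4 = w :* x :* e :* c
        P4′ = g′ :* b′ :+ x :* f′ :* d′ :+ w :* h′ :* a ; M4′ = w :* x :* e′ :* c′
        H1 = a :* a′ :+ b :* b′ :+ x :* x :* (c :* c′ :+ d :* d′)
        H2 = f :* f′ :+ g :* g′ :+ w :* w :* (e :* e′ :+ h :* h′)
    in (P1 :* P1′ :+ P2 :* P2′ :+ P3 :* P3′ :+ P4 :* P4′) :+ (M1 :* M1′ :+ M2 :* M2′ :+ M3 :* M3′ :+ M4 :* M4′)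
       := H1 :* H2 :+ ((P1 :* M1′ :+ M1 :* P1′) :+ (P2 :* M2′ :+ M2 :* P2′) :+ (P3 :* M3′ :+ M3 :* P3′) :+ (P4 :* M4′ :+ M4 :* P4′))) refl

module NormProduct {c ℓ} (S : CommutativeRing c ℓ) where
  open CommutativeRing S
  open NormProductSigned commutativeSemiring public using (block)
  open NormProductSigned commutativeSemiring using (expand-signed; cross-terms)
  open RingProperties ring using (-1*x≈-x; -‿involutive)
  open SetoidReasoning setoid

  normProduct : ∀ a a′ b b′ c c′ d d′ f f′ g g′ e e′ h h′ x w →
    let ν = - 1#
        H1 = a * a′ + b * b′ + x * x * (c * c′ + d * d′)
        H2 = f * f′ + g * g′ + w * w * (e * e′ + h * h′)
    in block x w f a g′ (ν * c) e′ (ν * b) h (ν * d′) * block x w f′ a′ g (ν * c′) e (ν * b′) h′ (ν * d)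
     + block x w f′ b g′ (ν * d) e a h c′ * block x w f b′ g (ν * d′) e′ a′ h′ c
     + block x w g a f′ c h (ν * b′) e′ d * block x w g′ a′ f c′ h′ (ν * b) e d′
     + block x w g b f d h a′ e (ν * c) * block x w g′ b′ f′ d′ h′ a e′ (ν * c′)
     ≈ H1 * H2
  normProduct a a′ b b′ c c′ d d′ f f′ g g′ e e′ h h′ x w =
    let ν = - 1#
        P1 = f * a ; M1 = x * g′ * c + w * e′ * b + w * x * h * d′
        P1′ = f′ * a′ ; M1′ = x * g * c′ + w * e * b′ + w * x * h′ * d
        P2 = f′ * b + w * e * a + w * x * h * c′ ; M2 = x * g′ * d
        P2′ = f * b′ + w * e′ * a′ + w * x * h′ * c ; M2′ = x * g * d′
        P3 = g * a + x * f′ * c + w * x * e′ * d ; M3 = w * h * b′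
        P3′ = g′ * a′ + x * f * c′ + w * x * e * d′ ; M3′ = w * h′ * b
        P4 = g * b + x * f * d + w * h * a′ ; M4 = w * x * e * c
        P4′ = g′ * b′ + x * f′ * d′ + w * h′ * a ; M4′ = w * x * e′ * c′
        H1 = a * a′ + b * b′ + x * x * (c * c′ + d * d′)
        H2 = f * f′ + g * g′ + w * w * (e * e′ + h * h′)
        ΣP = P1 * P1′ + P2 * P2′ + P3 * P3′ + P4 * P4′
        ΣM = M1 * M1′ + M2 * M2′ + M3 * M3′ + M4 * M4′
        ΣX = (P1 * M1′ + M1 * P1′) + (P2 * M2′ + M2 * P2′) + (P3 * M3′ + M3 * P3′) + (P4 * M4′ + M4 * P4′)
        ν²≈1 : ν * ν ≈ 1#
        ν²≈1 = trans (-1*x≈-x (- 1#)) (-‿involutive 1#)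
    in begin
    _                        ≈⟨ expand-signed a a′ b b′ c c′ d d′ f f′ g g′ e e′ h h′ x w ν ⟩
    (ΣP + ν * ν * ΣM) + ν * ΣX ≈⟨ +-cong (+-congˡ (trans (*-congʳ ν²≈1) (*-identityˡ ΣM))) (-1*x≈-x ΣX) ⟩
    (ΣP + ΣM) + - ΣX         ≈⟨ +-congʳ (cross-terms a a′ b b′ c c′ d d′ f f′ g g′ e e′ h h′ x w) ⟩
    (H1 * H2 + ΣX) + - ΣX    ≈⟨ +-assoc _ _ _ ⟩
    H1 * H2 + (ΣX + - ΣX)    ≈⟨ +-congˡ (-‿inverseʳ ΣX) ⟩
    H1 * H2 + 0#             ≈⟨ +-identityʳ _ ⟩
    H1 * H2                  ∎

-- Polynomials over R as coefficient lists, with the operations addList,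
-- mulList and nth of Defs (which live in LaurentPoly R ⋆, hence the otherwise
-- unused parameter ⋆).  Lists are equal as polynomials when all coefficients
-- agree, so trailing zeros do not matter; this makes them a commutative ring.
module Polynomials {c ℓ : Level} (R : CommutativeRing c ℓ)
    (⋆ : CommutativeRing.Carrier R → CommutativeRing.Carrier R) where
  open CommutativeRing R
  open LaurentPoly R ⋆ using (addList; mulList; nth)
  open RingProperties ring using (-0#≈0#)
  open SetoidReasoning setoid
  open import Algebra.Properties.CommutativeSemigroup +-commutativeSemigroup
    using (interchange) renaming (x∙yz≈y∙xz to x+[y+z]≈y+[x+z])

  infix 4 _≋_
  record _≋_ (p q : List Carrier) : Set ℓ where
    constructor mk≋
    field at : ∀ k → nth p k ≈ nth q k
  open _≋_ public

  infixl 6 _⊕_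
  infixl 7 _⊛_

  _⊕_ : List Carrier → List Carrier → List Carrier
  _⊕_ = addList

  _⊛_ : List Carrier → List Carrier → List Carrier
  _⊛_ = mulList

  neg : List Carrier → List Carrier
  neg = map (-_)

  scal : Carrier → List Carrier → List Carrier
  scal a = map (a *_)

  -- the reciprocal conjugate: for s of length k, φ_(bar s) = x^(k-1) φ_s*
  bar : List Carrier → List Carrier
  bar l = reverse (map ⋆ l)

  -- the Hall norm x^(k-1) φ_s φ_s* as a polynomial
  norm : List Carrier → List Carrier
  norm l = mulList l (bar l)

  shift : List Carrier → List Carrier
  shift p = 0# ∷ p

  ≋-refl : ∀ {p} → p ≋ p
  ≋-refl = mk≋ λ k → refl

  ≋-sym : ∀ {p q} → p ≋ q → q ≋ p
  ≋-sym e = mk≋ λ k → sym (at e k)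

  ≋-trans : ∀ {p q r} → p ≋ q → q ≋ r → p ≋ r
  ≋-trans e f = mk≋ λ k → trans (at e k) (at f k)

  nth-add : ∀ p q k → nth (p ⊕ q) k ≈ nth p k + nth q k
  nth-add [] q k = sym (+-identityˡ _)
  nth-add (a ∷ p) [] k = sym (+-identityʳ _)
  nth-add (a ∷ p) (b ∷ q) zero = refl
  nth-add (a ∷ p) (b ∷ q) (suc k) = nth-add p q k

  nth-neg : ∀ p k → nth (neg p) k ≈ - nth p k
  nth-neg [] k = sym -0#≈0#
  nth-neg (a ∷ p) zero = refl
  nth-neg (a ∷ p) (suc k) = nth-neg p k

  nth-scal : ∀ a p k → nth (scal a p) k ≈ a * nth p k
  nth-scal a [] k = sym (zeroʳ a)
  nth-scal a (b ∷ p) zero = refl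
  nth-scal a (b ∷ p) (suc k) = nth-scal a p k

  nth-mul-cons : ∀ a p q k → nth ((a ∷ p) ⊛ q) k ≈ a * nth q k + nth (shift (p ⊛ q)) k
  nth-mul-cons a p q k = trans (nth-add (scal a q) (shift (p ⊛ q)) k) (+-congʳ (nth-scal a q k))

  nth-shift-add : ∀ p q k → nth (shift (p ⊕ q)) k ≈ nth (shift p) k + nth (shift q) k
  nth-shift-add p q zero = sym (+-identityˡ _)
  nth-shift-add p q (suc k) = nth-add p q k

  add-cong : ∀ {p p′ q q′} → p ≋ p′ → q ≋ q′ → p ⊕ q ≋ p′ ⊕ q′
  add-cong {p} {p′} {q} {q′} e f = mk≋ λ k →
    trans (nth-add p q k) (trans (+-cong (at e k) (at f k)) (sym (nth-add p′ q′ k)))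

  add-assoc : ∀ p q r → p ⊕ q ⊕ r ≋ p ⊕ (q ⊕ r)
  add-assoc p q r = mk≋ λ k → begin
    nth (p ⊕ q ⊕ r) k             ≈⟨ nth-add (p ⊕ q) r k ⟩
    nth (p ⊕ q) k + nth r k       ≈⟨ +-congʳ (nth-add p q k) ⟩
    (nth p k + nth q k) + nth r k ≈⟨ +-assoc _ _ _ ⟩
    nth p k + (nth q k + nth r k) ≈⟨ +-congˡ (sym (nth-add q r k)) ⟩
    nth p k + nth (q ⊕ r) k       ≈⟨ sym (nth-add p (q ⊕ r) k) ⟩
    nth (p ⊕ (q ⊕ r)) k           ∎

  add-comm : ∀ p q → p ⊕ q ≋ q ⊕ p
  add-comm p q = mk≋ λ k → trans (nth-add p q k) (trans (+-comm _ _) (sym (nth-add q p k)))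

  add-idʳ : ∀ p → p ⊕ [] ≋ p
  add-idʳ p = mk≋ λ k → trans (nth-add p [] k) (+-identityʳ _)

  neg-invˡ : ∀ p → neg p ⊕ p ≋ []
  neg-invˡ p = mk≋ λ k → trans (nth-add (neg p) p k) (trans (+-congʳ (nth-neg p k)) (-‿inverseˡ _))

  neg-invʳ : ∀ p → p ⊕ neg p ≋ []
  neg-invʳ p = mk≋ λ k → trans (nth-add p (neg p) k) (trans (+-congˡ (nth-neg p k)) (-‿inverseʳ _))

  neg-cong : ∀ {p q} → p ≋ q → neg p ≋ neg q
  neg-cong {p} {q} e = mk≋ λ k → trans (nth-neg p k) (trans (-‿cong (at e k)) (sym (nth-neg q k)))

  shift-cong : ∀ {p q} → p ≋ q → shift p ≋ shift q
  shift-cong e = mk≋ λ { zero → refl ; (suc k) → at e k }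

  -- a product with a zero polynomial is zero (needed because lists of zeros ≋ [])
  mul-zero : ∀ p q → (∀ k → nth p k ≈ 0#) → ∀ k → nth (p ⊛ q) k ≈ 0#
  mul-zero [] q z k = refl
  mul-zero (a ∷ p) q z k = trans (nth-mul-cons a p q k)
    (trans (+-cong (trans (*-congʳ (z 0)) (zeroˡ _)) (shifted k)) (+-identityˡ _))
    where
    shifted : ∀ k → nth (shift (p ⊛ q)) k ≈ 0#
    shifted zero = refl
    shifted (suc k) = mul-zero p q (λ j → z (suc j)) k

  mul-cong : ∀ {p p′ q q′} → p ≋ p′ → q ≋ q′ → p ⊛ q ≋ p′ ⊛ q′
  mul-cong {[]} {[]} e f = ≋-refl
  mul-cong {[]} {b ∷ p′} {q} {q′} e f = mk≋ λ k → sym (mul-zero (b ∷ p′) q′ (λ j → sym (at e j)) k)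
  mul-cong {a ∷ p} {[]} {q} {q′} e f = mk≋ λ k → mul-zero (a ∷ p) q (at e) k
  mul-cong {a ∷ p} {b ∷ p′} {q} {q′} e f = mk≋ λ k →
    trans (nth-mul-cons a p q k)
      (trans (+-cong (*-cong (at e 0) (at f k)) (at (shift-cong (mul-cong {p} {p′} (mk≋ λ j → at e (suc j)) f)) k))
        (sym (nth-mul-cons b p′ q′ k)))

  distribˡ-⊛ : ∀ p q r → p ⊛ (q ⊕ r) ≋ p ⊛ q ⊕ p ⊛ r
  distribˡ-⊛ [] q r = ≋-refl
  distribˡ-⊛ (a ∷ p) q r = mk≋ λ k → begin
    nth ((a ∷ p) ⊛ (q ⊕ r)) k ≈⟨ nth-mul-cons a p (q ⊕ r) k ⟩
    a * nth (q ⊕ r) k + nth (shift (p ⊛ (q ⊕ r))) k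
      ≈⟨ +-cong (trans (*-congˡ (nth-add q r k)) (distribˡ a _ _))
                (trans (at (shift-cong (distribˡ-⊛ p q r)) k) (nth-shift-add (p ⊛ q) (p ⊛ r) k)) ⟩
    (a * nth q k + a * nth r k) + (nth (shift (p ⊛ q)) k + nth (shift (p ⊛ r)) k)
      ≈⟨ interchange _ _ _ _ ⟩
    (a * nth q k + nth (shift (p ⊛ q)) k) + (a * nth r k + nth (shift (p ⊛ r)) k)
      ≈⟨ sym (+-cong (nth-mul-cons a p q k) (nth-mul-cons a p r k)) ⟩
    nth ((a ∷ p) ⊛ q) k + nth ((a ∷ p) ⊛ r) k ≈⟨ sym (nth-add ((a ∷ p) ⊛ q) ((a ∷ p) ⊛ r) k) ⟩
    nth ((a ∷ p) ⊛ q ⊕ (a ∷ p) ⊛ r) k ∎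

  distribʳ-⊛ : ∀ p q r → (p ⊕ q) ⊛ r ≋ p ⊛ r ⊕ q ⊛ r
  distribʳ-⊛ [] q r = ≋-refl
  distribʳ-⊛ (a ∷ p) [] r = ≋-sym (add-idʳ ((a ∷ p) ⊛ r))
  distribʳ-⊛ (a ∷ p) (b ∷ q) r = mk≋ λ k → begin
    nth (((a + b) ∷ p ⊕ q) ⊛ r) k ≈⟨ nth-mul-cons (a + b) (p ⊕ q) r k ⟩
    (a + b) * nth r k + nth (shift ((p ⊕ q) ⊛ r)) k
      ≈⟨ +-cong (distribʳ _ a b) (trans (at (shift-cong (distribʳ-⊛ p q r)) k) (nth-shift-add (p ⊛ r) (q ⊛ r) k)) ⟩
    (a * nth r k + b * nth r k) + (nth (shift (p ⊛ r)) k + nth (shift (q ⊛ r)) k)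
      ≈⟨ interchange _ _ _ _ ⟩
    (a * nth r k + nth (shift (p ⊛ r)) k) + (b * nth r k + nth (shift (q ⊛ r)) k)
      ≈⟨ sym (+-cong (nth-mul-cons a p r k) (nth-mul-cons b q r k)) ⟩
    nth ((a ∷ p) ⊛ r) k + nth ((b ∷ q) ⊛ r) k ≈⟨ sym (nth-add ((a ∷ p) ⊛ r) ((b ∷ q) ⊛ r) k) ⟩
    nth ((a ∷ p) ⊛ r ⊕ (b ∷ q) ⊛ r) k ∎

  mul-nilʳ : ∀ p → p ⊛ [] ≋ []
  mul-nilʳ [] = ≋-refl
  mul-nilʳ (a ∷ p) = mk≋ λ { zero → refl ; (suc k) → at (mul-nilʳ p) k }

  mul-consʳ : ∀ p b q → p ⊛ (b ∷ q) ≋ scal b p ⊕ shift (p ⊛ q)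
  mul-consʳ [] b q = mk≋ λ { zero → refl ; (suc k) → refl }
  mul-consʳ (a ∷ p) b q = mk≋ λ
    { zero → trans (+-identityʳ _) (trans (*-comm a b) (sym (+-identityʳ _)))
    ; (suc k) → begin
      nth (scal a q ⊕ p ⊛ (b ∷ q)) k ≈⟨ nth-add (scal a q) (p ⊛ (b ∷ q)) k ⟩
      nth (scal a q) k + nth (p ⊛ (b ∷ q)) k
        ≈⟨ +-congˡ (trans (at (mul-consʳ p b q) k) (nth-add (scal b p) (shift (p ⊛ q)) k)) ⟩
      nth (scal a q) k + (nth (scal b p) k + nth (shift (p ⊛ q)) k) ≈⟨ x+[y+z]≈y+[x+z] _ _ _ ⟩
      nth (scal b p) k + (nth (scal a q) k + nth (shift (p ⊛ q)) k)
        ≈⟨ +-congˡ (sym (nth-add (scal a q) (shift (p ⊛ q)) k)) ⟩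
      nth (scal b p) k + nth ((a ∷ p) ⊛ q) k ≈⟨ sym (nth-add (scal b p) ((a ∷ p) ⊛ q) k) ⟩
      nth (scal b p ⊕ (a ∷ p) ⊛ q) k ∎ }

  mul-comm : ∀ p q → p ⊛ q ≋ q ⊛ p
  mul-comm [] q = ≋-sym (mul-nilʳ q)
  mul-comm (a ∷ p) q = mk≋ λ k → begin
    nth ((a ∷ p) ⊛ q) k                       ≈⟨ nth-add (scal a q) (shift (p ⊛ q)) k ⟩
    nth (scal a q) k + nth (shift (p ⊛ q)) k  ≈⟨ +-congˡ (at (shift-cong (mul-comm p q)) k) ⟩
    nth (scal a q) k + nth (shift (q ⊛ p)) k  ≈⟨ sym (nth-add (scal a q) (shift (q ⊛ p)) k) ⟩
    nth (scal a q ⊕ shift (q ⊛ p)) k          ≈⟨ sym (at (mul-consʳ q a p) k) ⟩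
    nth (q ⊛ (a ∷ p)) k                       ∎

  scal-mul : ∀ a q r → scal a q ⊛ r ≋ scal a (q ⊛ r)
  scal-mul a [] r = mk≋ λ k → trans (sym (zeroʳ a)) (sym (nth-scal a [] k))
  scal-mul a (b ∷ q) r = mk≋ λ k → begin
    nth (scal a (b ∷ q) ⊛ r) k ≈⟨ nth-mul-cons (a * b) (scal a q) r k ⟩
    (a * b) * nth r k + nth (shift (scal a q ⊛ r)) k ≈⟨ +-cong (*-assoc a b _) (at (shift-cong (scal-mul a q r)) k) ⟩
    a * (b * nth r k) + nth (shift (scal a (q ⊛ r))) k ≈⟨ +-congˡ (shifted k) ⟩
    a * (b * nth r k) + a * nth (shift (q ⊛ r)) k ≈⟨ sym (distribˡ a _ _) ⟩
    a * (b * nth r k + nth (shift (q ⊛ r)) k) ≈⟨ *-congˡ (sym (nth-mul-cons b q r k)) ⟩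
    a * nth ((b ∷ q) ⊛ r) k ≈⟨ sym (nth-scal a ((b ∷ q) ⊛ r) k) ⟩
    nth (scal a ((b ∷ q) ⊛ r)) k ∎
    where
    shifted : ∀ k → nth (shift (scal a (q ⊛ r))) k ≈ a * nth (shift (q ⊛ r)) k
    shifted zero = sym (zeroʳ a)
    shifted (suc k) = nth-scal a (q ⊛ r) k

  shift-mul : ∀ p r → shift p ⊛ r ≋ shift (p ⊛ r)
  shift-mul p r = mk≋ λ k → trans (nth-mul-cons 0# p r k) (trans (+-congʳ (zeroˡ _)) (+-identityˡ _))

  mul-assoc : ∀ p q r → p ⊛ q ⊛ r ≋ p ⊛ (q ⊛ r)
  mul-assoc [] q r = ≋-refl
  mul-assoc (a ∷ p) q r = ≋-trans (distribʳ-⊛ (scal a q) (shift (p ⊛ q)) r)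
    (add-cong (scal-mul a q r) (≋-trans (shift-mul (p ⊛ q) r) (shift-cong (mul-assoc p q r))))

  mul-idˡ : ∀ q → (1# ∷ []) ⊛ q ≋ q
  mul-idˡ q = mk≋ λ k → trans (nth-mul-cons 1# [] q k) (trans (+-cong (*-identityˡ _) (shifted k)) (+-identityʳ _))
    where
    shifted : ∀ k → nth (shift ([] ⊛ q)) k ≈ 0#
    shifted zero = refl
    shifted (suc k) = refl

  ≋-isCommutativeRing : IsCommutativeRing _≋_ _⊕_ _⊛_ neg [] (1# ∷ [])
  ≋-isCommutativeRing = record
    { isRing = record
      { +-isAbelianGroup = record
        { isGroup = record
          { isMonoid = record
            { isSemigroup = record
              { isMagma = record
                { isEquivalence = record { refl = ≋-refl ; sym = ≋-sym ; trans = ≋-trans }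
                ; ∙-cong = add-cong }
              ; assoc = add-assoc }
            ; identity = (λ p → ≋-refl) , add-idʳ }
          ; inverse = neg-invˡ , neg-invʳ
          ; ⁻¹-cong = neg-cong }
        ; comm = add-comm }
      ; *-cong = mul-cong
      ; *-assoc = mul-assoc
      ; *-identity = mul-idˡ , (λ q → ≋-trans (mul-comm q (1# ∷ [])) (mul-idˡ q))
      ; distrib = distribˡ-⊛ , (λ r p q → distribʳ-⊛ p q r) }
    ; *-comm = mul-comm }

  R[X] : CommutativeRing c ℓ
  R[X] = record { isCommutativeRing = ≋-isCommutativeRing }

  module ℙ = CommutativeRing R[X]

  -- congruence in one argument; the fixed argument is given explicitly since it
  -- cannot be recovered once ⊕ and ⊛ have computed
  ⊕-congˡ : ∀ p {q q′} → q ≋ q′ → p ⊕ q ≋ p ⊕ q′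
  ⊕-congˡ p = add-cong (≋-refl {p})

  ⊕-congʳ : ∀ q {p p′} → p ≋ p′ → p ⊕ q ≋ p′ ⊕ q
  ⊕-congʳ q e = add-cong e (≋-refl {q})

  ⊛-congˡ : ∀ p {q q′} → q ≋ q′ → p ⊛ q ≋ p ⊛ q′
  ⊛-congˡ p = mul-cong (≋-refl {p})
  open Horner R[X] public
  open import Algebra.Properties.Semiring.Exp ℙ.semiring public using (_^_; ^-homo-*; ^-assocʳ; ^-congˡ)

module Substitution {c ℓ : Level} (R : CommutativeRing c ℓ)
    (⋆ : CommutativeRing.Carrier R → CommutativeRing.Carrier R) where
  open CommutativeRing R
  open LaurentPoly R ⋆ using (nth)
  open Polynomials R ⋆ public
  open RingProperties ring using (-1*x≈-x)
  open SetoidReasoning ℙ.setoid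
  open NatSolver ℙ.commutativeSemiring

  X : List Carrier
  X = 0# ∷ 1# ∷ []

  cst : Carrier → List Carrier
  cst a = a ∷ []

  compose : List Carrier → List Carrier → List Carrier
  compose p V = horner V (map cst p)

  cst-zero : ∀ {a} → a ≈ 0# → cst a ≋ []
  cst-zero e = mk≋ λ { zero → e ; (suc k) → refl }

  cst-cong : ∀ {a b} → a ≈ b → cst a ≋ cst b
  cst-cong e = mk≋ λ { zero → e ; (suc k) → refl }

  cst-mul : ∀ a b → cst (a * b) ≋ cst a ⊛ cst b
  cst-mul a b = mk≋ λ { zero → sym (+-identityʳ _) ; (suc k) → refl }

  X-mul : ∀ p → X ⊛ p ≋ shift p
  X-mul p = ℙ.trans (shift-mul (1# ∷ []) p) (shift-cong (mul-idˡ p))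

  cons-X : ∀ a p → (a ∷ p) ≋ cst a ⊕ X ⊛ p
  cons-X a p = ℙ.sym (ℙ.trans (⊕-congˡ (cst a) (X-mul p)) (mk≋ λ { zero → +-identityʳ a ; (suc k) → refl }))

  compose-X : ∀ p → compose p X ≋ p
  compose-X [] = ℙ.refl
  compose-X (a ∷ p) = ℙ.trans (⊕-congˡ (cst a) (⊛-congˡ X (compose-X p))) (ℙ.sym (cons-X a p))

  compose-zero : ∀ p V → (∀ k → nth p k ≈ 0#) → compose p V ≋ []
  compose-zero [] V z = ℙ.refl
  compose-zero (a ∷ p) V z = begin
    cst a ⊕ V ⊛ compose p V ≈⟨ ℙ.+-cong (cst-zero (z 0)) (⊛-congˡ V (compose-zero p V (λ k → z (suc k)))) ⟩
    [] ⊕ V ⊛ []             ≈⟨ ℙ.zeroʳ V ⟩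
    []                      ∎

  compose-cong : ∀ {p q} V → p ≋ q → compose p V ≋ compose q V
  compose-cong {[]} {[]} V e = ℙ.refl
  compose-cong {[]} {b ∷ q} V e = ℙ.sym (compose-zero (b ∷ q) V (λ k → sym (at e k)))
  compose-cong {a ∷ p} {[]} V e = compose-zero (a ∷ p) V (at e)
  compose-cong {a ∷ p} {b ∷ q} V e =
    ℙ.+-cong (cst-cong (at e 0)) (⊛-congˡ V (compose-cong {p} {q} V (mk≋ λ k → at e (suc k))))

  compose-add : ∀ p q V → compose (p ⊕ q) V ≋ compose p V ⊕ compose q V
  compose-add [] q V = ℙ.sym (ℙ.+-identityˡ _)
  compose-add (a ∷ p) [] V = ℙ.sym (ℙ.+-identityʳ _)
  compose-add (a ∷ p) (b ∷ q) V = begin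
    cst (a + b) ⊕ V ⊛ compose (p ⊕ q) V              ≈⟨ ⊕-congˡ (cst (a + b)) (⊛-congˡ V (compose-add p q V)) ⟩
    (cst a ⊕ cst b) ⊕ V ⊛ (compose p V ⊕ compose q V)
      ≈⟨ solve 5 (λ a b v x y → (a :+ b) :+ v :* (x :+ y) := (a :+ v :* x) :+ (b :+ v :* y)) ℙ.refl
           (cst a) (cst b) V (compose p V) (compose q V) ⟩
    compose (a ∷ p) V ⊕ compose (b ∷ q) V             ∎

  compose-scal : ∀ a p V → compose (scal a p) V ≋ cst a ⊛ compose p V
  compose-scal a [] V = ℙ.sym (ℙ.zeroʳ (cst a))
  compose-scal a (b ∷ p) V = begin
    cst (a * b) ⊕ V ⊛ compose (scal a p) V ≈⟨ ℙ.+-cong (cst-mul a b) (⊛-congˡ V (compose-scal a p V)) ⟩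
    cst a ⊛ cst b ⊕ V ⊛ (cst a ⊛ compose p V)
      ≈⟨ solve 4 (λ a b v x → a :* b :+ v :* (a :* x) := a :* (b :+ v :* x)) ℙ.refl (cst a) (cst b) V (compose p V) ⟩
    cst a ⊛ compose (b ∷ p) V              ∎

  compose-mul : ∀ p q V → compose (p ⊛ q) V ≋ compose p V ⊛ compose q V
  compose-mul [] q V = ℙ.sym (ℙ.zeroˡ (compose q V))
  compose-mul (a ∷ p) q V = begin
    compose (scal a q ⊕ shift (p ⊛ q)) V ≈⟨ compose-add (scal a q) (shift (p ⊛ q)) V ⟩
    compose (scal a q) V ⊕ (cst 0# ⊕ V ⊛ compose (p ⊛ q) V)
      ≈⟨ ℙ.+-cong (compose-scal a q V) (ℙ.+-cong (cst-zero refl) (⊛-congˡ V (compose-mul p q V))) ⟩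
    cst a ⊛ compose q V ⊕ ([] ⊕ V ⊛ (compose p V ⊛ compose q V))
      ≈⟨ solve 4 (λ a v x y → a :* y :+ (con 0 :+ v :* (x :* y)) := (a :+ v :* x) :* y) ℙ.refl
           (cst a) V (compose p V) (compose q V) ⟩
    compose (a ∷ p) V ⊛ compose q V      ∎

  compose-neg : ∀ p V → compose (neg p) V ≋ ℙ.- ℙ.1# ⊛ compose p V
  compose-neg p V = ℙ.trans (compose-cong V neg-scal) (compose-scal (- 1#) p V)
    where
    neg-scal : neg p ≋ scal (- 1#) p
    neg-scal = mk≋ λ k → trans (nth-neg p k) (trans (sym (-1*x≈-x _)) (sym (nth-scal (- 1#) p k)))

  compose-cst : ∀ a V → compose (cst a) V ≋ cst a
  compose-cst a V = ℙ.trans (ℙ.+-congˡ (ℙ.zeroʳ V)) (ℙ.+-identityʳ (cst a))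

  compose-X-at : ∀ V → compose X V ≋ V
  compose-X-at V = begin
    cst 0# ⊕ V ⊛ (cst 1# ⊕ V ⊛ []) ≈⟨ ℙ.+-cong (cst-zero refl) (⊛-congˡ V (⊕-congˡ (cst 1#) (ℙ.zeroʳ V))) ⟩
    [] ⊕ V ⊛ (cst 1# ⊕ [])         ≈⟨ solve 1 (λ v → con 0 :+ v :* (con 1 :+ con 0) := v) ℙ.refl V ⟩
    V                              ∎

  compose-pow : ∀ k V → compose (X ^ k) V ≋ V ^ k
  compose-pow zero V = compose-cst 1# V
  compose-pow (suc k) V = ℙ.trans (compose-mul X (X ^ k) V) (ℙ.*-cong (compose-X-at V) (compose-pow k V))

  pow-square : ∀ V n → (V ⊛ V) ^ n ≋ V ^ (2 ℕ.* n)
  pow-square V n = ℙ.trans (^-congˡ n (⊛-congˡ V (ℙ.sym (ℙ.*-identityʳ V)))) (^-assocʳ V 2 n)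

  interleave-poly : ∀ u v → length u ≡ suc (length v) →
    interleave u v ≋ compose u (X ⊛ X) ⊕ X ⊛ compose v (X ⊛ X)
  interleave-poly u v eq = begin
    interleave u v                                ≈⟨ ℙ.sym (compose-X (interleave u v)) ⟩
    horner X (map cst (interleave u v))           ≡⟨ ≡.cong (horner X) (map-interleave cst u v) ⟩
    horner X (interleave (map cst u) (map cst v)) ≈⟨ horner-interleave X (map cst u) (map cst v) lengths ⟩
    compose u (X ⊛ X) ⊕ X ⊛ compose v (X ⊛ X)     ∎
    where
    lengths = ≡.trans (length-map cst u) (≡.trans eq (≡.cong suc (≡.sym (length-map cst v))))

  append-poly : ∀ r s → (r ++ s) ≋ r ⊕ X ^ length r ⊛ s
  append-poly [] s = ℙ.sym (ℙ.*-identityˡ s)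
  append-poly (a ∷ r) s = begin
    a ∷ (r ++ s)                               ≈⟨ cons-X a (r ++ s) ⟩
    cst a ⊕ X ⊛ (r ++ s)                       ≈⟨ ⊕-congˡ (cst a) (⊛-congˡ X (append-poly r s)) ⟩
    cst a ⊕ X ⊛ (r ⊕ X ^ length r ⊛ s)
      ≈⟨ solve 5 (λ a x r p s → a :+ x :* (r :+ p :* s) := (a :+ x :* r) :+ (x :* p) :* s) ℙ.refl
           (cst a) X r (X ^ length r) s ⟩
    (cst a ⊕ X ⊛ r) ⊕ X ^ length (a ∷ r) ⊛ s   ≈⟨ ℙ.+-congʳ (ℙ.sym (cons-X a r)) ⟩
    (a ∷ r) ⊕ X ^ length (a ∷ r) ⊛ s           ∎

  concat-poly : ∀ N rows → ListAll.All (λ r → length r ≡ N) rows → concat rows ≋ horner (X ^ N) rows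
  concat-poly N [] [] = ℙ.refl
  concat-poly N (r ∷ rows) (l ∷ ls) = ℙ.trans (append-poly r (concat rows))
    (ℙ.+-congˡ (ℙ.*-cong (ℙ.reflexive (≡.cong (X ^_) l)) (concat-poly N rows ls)))

module Conjugation {c ℓ : Level} (R : CommutativeRing c ℓ)
    (⋆ : CommutativeRing.Carrier R → CommutativeRing.Carrier R)
    (isInv : IsInvolutiveAutomorphism R ⋆) where
  open CommutativeRing R
  open Substitution R ⋆ public
  open IsInvolutiveAutomorphism isInv
  module ⋆-hom = RingMorphisms.IsRingHomomorphism isRingHomomorphism

  map-≋ : ∀ (f g : Carrier → Carrier) l → (∀ x → f x ≈ g x) → map f l ≋ map g l
  map-≋ f g [] e = ℙ.refl
  map-≋ f g (x ∷ l) e = mk≋ λ { zero → e x ; (suc k) → at (map-≋ f g l e) k }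

  length-bar : ∀ l → length (bar l) ≡ length l
  length-bar l = ≡.trans (length-reverse (map ⋆ l)) (length-map ⋆ l)

  bar-map : ∀ (f : Carrier → Carrier) l → bar (map f l) ≡ map (⋆ ∘ f) (reverse l)
  bar-map f l = ≡.trans (≡.cong reverse (≡.sym (map-∘ l))) (≡.sym (reverse-map (⋆ ∘ f) l))

  map-bar : ∀ (f : Carrier → Carrier) l → map f (bar l) ≡ map (f ∘ ⋆) (reverse l)
  map-bar f l = ≡.trans (reverse-map f (map ⋆ l)) (≡.trans (≡.cong reverse (≡.sym (map-∘ l))) (≡.sym (reverse-map (f ∘ ⋆) l)))

  bar-scal : ∀ y l → bar (scal y l) ≋ scal (⋆ y) (bar l)
  bar-scal y l = ℙ.trans (ℙ.reflexive (bar-map (y *_) l))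
    (ℙ.trans (map-≋ _ _ (reverse l) (⋆-hom.*-homo y)) (ℙ.reflexive (≡.sym (map-bar (⋆ y *_) l))))

  bar-neg : ∀ l → bar (neg l) ≋ neg (bar l)
  bar-neg l = ℙ.trans (ℙ.reflexive (bar-map -_ l))
    (ℙ.trans (map-≋ _ _ (reverse l) ⋆-hom.-‿homo) (ℙ.reflexive (≡.sym (map-bar -_ l))))

  bar-bar : ∀ l → bar (bar l) ≋ l
  bar-bar l = ℙ.trans (ℙ.reflexive bar-bar-map) (ℙ.trans (map-≋ _ _ l involutive) (ℙ.reflexive (map-id l)))
    where
    bar-bar-map : bar (bar l) ≡ map (⋆ ∘ ⋆) l
    bar-bar-map = ≡.trans (≡.cong reverse (map-bar ⋆ l))
      (≡.trans (≡.sym (reverse-map (⋆ ∘ ⋆) (reverse l))) (≡.cong (map (⋆ ∘ ⋆)) (reverse-involutive l)))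

module ProductConstruction {c ℓ : Level} (R : CommutativeRing c ℓ)
    (⋆ : CommutativeRing.Carrier R → CommutativeRing.Carrier R)
    (isInv : IsInvolutiveAutomorphism R ⋆) where
  open CommutativeRing R
  open Conjugation R ⋆ isInv public
  open NormProduct R[X] public using (block)
  open SetoidReasoning ℙ.setoid
  open NatSolver ℙ.commutativeSemiring

  row : List Carrier → List Carrier → Carrier → Carrier → List Carrier
  row X0 X1 y y′ = interleave (scal y X0) (scal y′ X1)

  product : (Y00 X00 Y01 X01 Y10 X10 Y11 X11 : List Carrier) → List Carrier
  product Y00 X00 Y01 X01 Y10 X10 Y11 X11 =
    concat (interleave (zipWith (row X00 X01) Y00 Y01) (zipWith (row X10 X11) Y10 Y11))

  X² : List Carrier
  X² = X ⊛ X

  _∘X² : List Carrier → List Carrier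
  l ∘X² = compose l X²

  private
    swap-X : ∀ a b y y′ → cst y ⊛ a ⊕ X ⊛ (cst y′ ⊛ b) ≋ cst y ⊛ a ⊕ cst y′ ⊛ (X ⊛ b)
    swap-X a b y y′ = solve 5 (λ a b y y′ x → y :* a :+ x :* (y′ :* b) := y :* a :+ y′ :* (x :* b)) ℙ.refl a b (cst y) (cst y′) X

  row-poly : ∀ X0 X1 → length X0 ≡ suc (length X1) → ∀ y y′ →
    row X0 X1 y y′ ≋ cst y ⊛ (X0 ∘X²) ⊕ cst y′ ⊛ (X ⊛ (X1 ∘X²))
  row-poly X0 X1 eq y y′ = begin
    interleave (scal y X0) (scal y′ X1)      ≈⟨ interleave-poly (scal y X0) (scal y′ X1) lengths ⟩
    scal y X0 ∘X² ⊕ X ⊛ (scal y′ X1 ∘X²)     ≈⟨ add-cong (compose-scal y X0 X²) (⊛-congˡ X (compose-scal y′ X1 X²)) ⟩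
    cst y ⊛ (X0 ∘X²) ⊕ X ⊛ (cst y′ ⊛ (X1 ∘X²)) ≈⟨ swap-X (X0 ∘X²) (X1 ∘X²) y y′ ⟩
    cst y ⊛ (X0 ∘X²) ⊕ cst y′ ⊛ (X ⊛ (X1 ∘X²)) ∎
    where
    lengths = ≡.trans (length-map (y *_) X0) (≡.trans eq (≡.cong suc (≡.sym (length-map (y′ *_) X1))))

  bar-row-poly : ∀ X0 X1 → length X0 ≡ suc (length X1) → ∀ y y′ →
    bar (row X0 X1 y y′) ≋ cst (⋆ y) ⊛ (bar X0 ∘X²) ⊕ cst (⋆ y′) ⊛ (X ⊛ (bar X1 ∘X²))
  bar-row-poly X0 X1 eq y y′ = begin
    reverse (map ⋆ (interleave (scal y X0) (scal y′ X1))) ≡⟨ ≡.cong reverse (map-interleave ⋆ (scal y X0) (scal y′ X1)) ⟩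
    reverse (interleave (map ⋆ (scal y X0)) (map ⋆ (scal y′ X1)))
      ≡⟨ reverse-interleave (map ⋆ (scal y X0)) (map ⋆ (scal y′ X1)) (lengths (map ⋆) (length-map ⋆)) ⟩
    interleave (bar (scal y X0)) (bar (scal y′ X1))
      ≈⟨ interleave-poly (bar (scal y X0)) (bar (scal y′ X1)) (lengths bar length-bar) ⟩
    bar (scal y X0) ∘X² ⊕ X ⊛ (bar (scal y′ X1) ∘X²)
      ≈⟨ add-cong (ℙ.trans (compose-cong X² (bar-scal y X0)) (compose-scal (⋆ y) (bar X0) X²))
                  (⊛-congˡ X (ℙ.trans (compose-cong X² (bar-scal y′ X1)) (compose-scal (⋆ y′) (bar X1) X²))) ⟩
    cst (⋆ y) ⊛ (bar X0 ∘X²) ⊕ X ⊛ (cst (⋆ y′) ⊛ (bar X1 ∘X²)) ≈⟨ swap-X (bar X0 ∘X²) (bar X1 ∘X²) (⋆ y) (⋆ y′) ⟩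
    cst (⋆ y) ⊛ (bar X0 ∘X²) ⊕ cst (⋆ y′) ⊛ (X ⊛ (bar X1 ∘X²)) ∎
    where
    lengths : ∀ (f : List Carrier → List Carrier) → (∀ l → length (f l) ≡ length l) →
      length (f (scal y X0)) ≡ suc (length (f (scal y′ X1)))
    lengths f p = ≡.trans (p (scal y X0)) (≡.trans (length-map (y *_) X0)
      (≡.trans eq (≡.cong suc (≡.sym (≡.trans (p (scal y′ X1)) (length-map (y′ *_) X1))))))

  All-length-zipWith : ∀ N (h : Carrier → Carrier → List Carrier) → (∀ y y′ → length (h y y′) ≡ N) →
    ∀ xs ys → ListAll.All (λ r → length r ≡ N) (zipWith h xs ys)
  All-length-zipWith N h hl [] ys = []
  All-length-zipWith N h hl (x ∷ xs) [] = []
  All-length-zipWith N h hl (x ∷ xs) (y ∷ ys) = hl x y ∷ All-length-zipWith N h hl xs ys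

  rows-poly : ∀ N (h0 h1 : Carrier → Carrier → List Carrier) (g : Carrier → Carrier) α0 β0 α1 β1
    (Ya Yb Yc Yd : List Carrier) →
    length Ya ≡ length Yb → length Yc ≡ length Yd → length Ya ≡ suc (length Yc) →
    (∀ y y′ → length (h0 y y′) ≡ N) → (∀ y y′ → length (h1 y y′) ≡ N) →
    (∀ y y′ → h0 y y′ ≋ cst (g y) ⊛ α0 ⊕ cst (g y′) ⊛ β0) →
    (∀ y y′ → h1 y y′ ≋ cst (g y) ⊛ α1 ⊕ cst (g y′) ⊛ β1) →
    let W = X ^ N ; G = λ Y → horner (W ⊛ W) (map (cst ∘ g) Y) in
    concat (interleave (zipWith h0 Ya Yb) (zipWith h1 Yc Yd)) ≋ (G Ya ⊛ α0 ⊕ G Yb ⊛ β0) ⊕ W ⊛ (G Yc ⊛ α1 ⊕ G Yd ⊛ β1)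
  rows-poly N h0 h1 g α0 β0 α1 β1 Ya Yb Yc Yd eab ecd eac l0 l1 H0 H1 = begin
    concat (interleave evens odds)
      ≈⟨ concat-poly N (interleave evens odds) (All-interleave (All-length-zipWith N h0 l0 Ya Yb) (All-length-zipWith N h1 l1 Yc Yd)) ⟩
    horner W (interleave evens odds)
      ≈⟨ horner-interleave W evens odds
           (≡.trans (length-zipWith-≡ h0 Ya Yb eab) (≡.trans eac (≡.cong suc (≡.sym (length-zipWith-≡ h1 Yc Yd ecd))))) ⟩
    horner (W ⊛ W) evens ⊕ W ⊛ horner (W ⊛ W) odds
      ≈⟨ add-cong (horner-zipWith h0 (cst ∘ g) α0 β0 (W ⊛ W) Ya Yb eab H0)
                  (⊛-congˡ W (horner-zipWith h1 (cst ∘ g) α1 β1 (W ⊛ W) Yc Yd ecd H1)) ⟩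
    (G Ya ⊛ α0 ⊕ G Yb ⊛ β0) ⊕ W ⊛ (G Yc ⊛ α1 ⊕ G Yd ⊛ β1) ∎
    where
    W = X ^ N
    G = λ Y → horner (W ⊛ W) (map (cst ∘ g) Y)
    evens = zipWith h0 Ya Yb
    odds = zipWith h1 Yc Yd

  record Shape (m n : ℕ) (Y00 X00 Y01 X01 Y10 X10 Y11 X11 : List Carrier) : Set where
    field
      len-Y00 : length Y00 ≡ suc m
      len-Y01 : length Y01 ≡ suc m
      len-Y10 : length Y10 ≡ m
      len-Y11 : length Y11 ≡ m
      len-X00 : length X00 ≡ suc n
      len-X01 : length X01 ≡ n
      len-X10 : length X10 ≡ suc n
      len-X11 : length X11 ≡ n

  module ProductPoly {m n Y00 X00 Y01 X01 Y10 X10 Y11 X11}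
      (shape : Shape m n Y00 X00 Y01 X01 Y10 X10 Y11 X11) where
    open Shape shape

    N : ℕ
    N = suc n ℕ.+ n

    W : List Carrier
    W = X ^ N

    _∘W² : List Carrier → List Carrier
    l ∘W² = compose l (W ⊛ W)

    private
      eX0 : length X00 ≡ suc (length X01)
      eX0 = ≡.trans len-X00 (≡.cong suc (≡.sym len-X01))
      eX1 : length X10 ≡ suc (length X11)
      eX1 = ≡.trans len-X10 (≡.cong suc (≡.sym len-X11))
      eY0 : length Y00 ≡ length Y01
      eY0 = ≡.trans len-Y00 (≡.sym len-Y01)
      eY1 : length Y10 ≡ length Y11
      eY1 = ≡.trans len-Y10 (≡.sym len-Y11)
      eY : length Y00 ≡ suc (length Y10)
      eY = ≡.trans len-Y00 (≡.cong suc (≡.sym len-Y10))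

      length-row : ∀ X0 X1 → length X0 ≡ suc n → length X1 ≡ n → ∀ y y′ → length (row X0 X1 y y′) ≡ N
      length-row X0 X1 l0 l1 y y′ = ≡.trans (length-interleave (scal y X0) (scal y′ X1))
        (≡.cong₂ ℕ._+_ (≡.trans (length-map _ X0) l0) (≡.trans (length-map _ X1) l1))

      length-bar-row : ∀ X0 X1 → length X0 ≡ suc n → length X1 ≡ n → ∀ y y′ → length (bar (row X0 X1 y y′)) ≡ N
      length-bar-row X0 X1 l0 l1 y y′ = ≡.trans (length-bar (row X0 X1 y y′)) (length-row X0 X1 l0 l1 y y′)

      evens = zipWith (row X00 X01) Y00 Y01
      odds = zipWith (row X10 X11) Y10 Y11
      bar-row0 = λ y y′ → bar (row X00 X01 y y′)
      bar-row1 = λ y y′ → bar (row X10 X11 y y′)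

    product-poly : product Y00 X00 Y01 X01 Y10 X10 Y11 X11 ≋
      block X W (Y00 ∘W²) (X00 ∘X²) (Y01 ∘W²) (X01 ∘X²) (Y10 ∘W²) (X10 ∘X²) (Y11 ∘W²) (X11 ∘X²)
    product-poly = rows-poly N (row X00 X01) (row X10 X11) id (X00 ∘X²) (X ⊛ (X01 ∘X²)) (X10 ∘X²) (X ⊛ (X11 ∘X²))
      Y00 Y01 Y10 Y11 eY0 eY1 eY (length-row X00 X01 len-X00 len-X01) (length-row X10 X11 len-X10 len-X11)
      (row-poly X00 X01 eX0) (row-poly X10 X11 eX1)

    bar-product : bar (product Y00 X00 Y01 X01 Y10 X10 Y11 X11) ≋
      concat (interleave (zipWith bar-row0 (reverse Y00) (reverse Y01)) (zipWith bar-row1 (reverse Y10) (reverse Y11)))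
    bar-product = begin
      reverse (map ⋆ (concat (interleave evens odds)))          ≡⟨ ≡.cong reverse (≡.sym (concat-map (interleave evens odds))) ⟩
      reverse (concat (map (map ⋆) (interleave evens odds)))    ≡⟨ reverse-concat (map (map ⋆) (interleave evens odds)) ⟩
      concat (reverse (map reverse (map (map ⋆) (interleave evens odds))))
        ≡⟨ ≡.cong (concat ∘ reverse) (≡.sym (map-∘ (interleave evens odds))) ⟩
      concat (reverse (map bar (interleave evens odds)))        ≡⟨ ≡.cong (concat ∘ reverse) (map-interleave bar evens odds) ⟩
      concat (reverse (interleave (map bar evens) (map bar odds)))
        ≡⟨ ≡.cong concat (reverse-interleave (map bar evens) (map bar odds) row-counts) ⟩
      concat (interleave (reverse (map bar evens)) (reverse (map bar odds)))
        ≡⟨ ≡.cong₂ (λ u v → concat (interleave (reverse u) (reverse v)))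
             (map-zipWith (row X00 X01) bar Y00 Y01) (map-zipWith (row X10 X11) bar Y10 Y11) ⟩
      concat (interleave (reverse (zipWith bar-row0 Y00 Y01)) (reverse (zipWith bar-row1 Y10 Y11)))
        ≡⟨ ≡.cong₂ (λ u v → concat (interleave u v)) (reverse-zipWith bar-row0 Y00 Y01 eY0) (reverse-zipWith bar-row1 Y10 Y11 eY1) ⟩
      concat (interleave (zipWith bar-row0 (reverse Y00) (reverse Y01)) (zipWith bar-row1 (reverse Y10) (reverse Y11))) ∎
      where
      row-counts : length (map bar evens) ≡ suc (length (map bar odds))
      row-counts = ≡.trans (length-map bar evens) (≡.trans (length-zipWith-≡ (row X00 X01) Y00 Y01 eY0)
        (≡.trans eY (≡.cong suc (≡.sym (≡.trans (length-map bar odds) (length-zipWith-≡ (row X10 X11) Y10 Y11 eY1))))))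

    bar-product-poly : bar (product Y00 X00 Y01 X01 Y10 X10 Y11 X11) ≋
      block X W (bar Y00 ∘W²) (bar X00 ∘X²) (bar Y01 ∘W²) (bar X01 ∘X²) (bar Y10 ∘W²) (bar X10 ∘X²) (bar Y11 ∘W²) (bar X11 ∘X²)
    bar-product-poly = ℙ.trans bar-product (ℙ.trans
      (rows-poly N bar-row0 bar-row1 ⋆ (bar X00 ∘X²) (X ⊛ (bar X01 ∘X²)) (bar X10 ∘X²) (X ⊛ (bar X11 ∘X²))
        (reverse Y00) (reverse Y01) (reverse Y10) (reverse Y11)
        (reversed Y00 Y01 eY0) (reversed Y10 Y11 eY1) (≡.trans (length-reverse Y00) (≡.trans eY (≡.cong suc (≡.sym (length-reverse Y10)))))
        (length-bar-row X00 X01 len-X00 len-X01) (length-bar-row X10 X11 len-X10 len-X11)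
        (bar-row-poly X00 X01 eX0) (bar-row-poly X10 X11 eX1))
      (ℙ.reflexive (≡.cong₂ (λ u v → u ⊕ W ⊛ v)
        (≡.cong₂ (λ s t → s ⊛ (bar X00 ∘X²) ⊕ t ⊛ (X ⊛ (bar X01 ∘X²))) (conj-scalars Y00) (conj-scalars Y01))
        (≡.cong₂ (λ s t → s ⊛ (bar X10 ∘X²) ⊕ t ⊛ (X ⊛ (bar X11 ∘X²))) (conj-scalars Y10) (conj-scalars Y11)))))
      where
      reversed : ∀ (Y Y′ : List Carrier) → length Y ≡ length Y′ → length (reverse Y) ≡ length (reverse Y′)
      reversed Y Y′ e = ≡.trans (length-reverse Y) (≡.trans e (≡.sym (length-reverse Y′)))
      conj-scalars : ∀ Y → horner (W ⊛ W) (map (cst ∘ ⋆) (reverse Y)) ≡ bar Y ∘W²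
      conj-scalars Y = ≡.cong (horner (W ⊛ W)) (≡.trans (map-∘ (reverse Y)) (≡.cong (map cst) (reverse-map ⋆ Y)))

    product-length : length (product Y00 X00 Y01 X01 Y10 X10 Y11 X11) ≡ (suc m ℕ.+ m) ℕ.* N
    product-length = ≡.trans
      (length-concat N (interleave evens odds)
        (All-interleave (All-length-zipWith N _ (length-row X00 X01 len-X00 len-X01) Y00 Y01)
                        (All-length-zipWith N _ (length-row X10 X11 len-X10 len-X11) Y10 Y11)))
      (≡.cong (ℕ._* N) (≡.trans (length-interleave evens odds)
        (≡.cong₂ ℕ._+_ (≡.trans (length-zipWith-≡ _ Y00 Y01 eY0) len-Y00) (≡.trans (length-zipWith-≡ _ Y10 Y11 eY1) len-Y10))))

-- The dictionary between the Laurent polynomials of Defs and coefficient lists: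
-- coefficient j of N s is coefficient j + (k-1) of norm s, and a constant is a
-- monomial K x^d after multiplying by x^d.
module LaurentDictionary {c ℓ : Level} (R : CommutativeRing c ℓ)
    (⋆ : CommutativeRing.Carrier R → CommutativeRing.Carrier R) where
  open CommutativeRing R
  open LaurentPoly R ⋆
  open Substitution R ⋆
  open SetoidReasoning setoid

  cf : List Carrier → ℤ → Carrier
  cf l (+ k) = nth l k
  cf l -[1+ k ] = 0#

  coeff-cf : ∀ o l j → coeff (mkL o l) j ≡ cf l (j ℤ.- o)
  coeff-cf o l j with j ℤ.- o
  ... | + k = ≡.refl
  ... | -[1+ k ] = ≡.refl

  cf-add : ∀ p q z → cf (p ⊕ q) z ≈ cf p z + cf q z
  cf-add p q (+ k) = nth-add p q k
  cf-add p q -[1+ k ] = sym (+-identityʳ 0#)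

  cf-pad : ∀ d l z → cf (replicate d 0# ++ l) z ≡ cf l (z ℤ.- + d)
  cf-pad zero l z = ≡.cong (cf l) (≡.sym (ℤP.+-identityʳ z))
  cf-pad (suc d) l (+ zero) = ≡.refl
  cf-pad (suc d) l (+ suc k) = ≡.trans (cf-pad d l (+ k))
    (≡.cong (cf l) (≡.trans (ℤP.m-n≡m⊖n k d) (≡.trans (≡.sym (ℤP.[1+m]⊖[1+n]≡m⊖n k d)) (≡.sym (ℤP.m-n≡m⊖n (suc k) (suc d))))))
  cf-pad (suc d) l -[1+ k ] = ≡.refl

  shiftTo-cf : ∀ o p j → o ℤ.≤ off p → cf (shiftTo o p) (j ℤ.- o) ≈ coeff p j
  shiftTo-cf o (mkL o′ l) j o≤o′ = begin
    cf (replicate ∣ o′ ℤ.- o ∣ 0# ++ l) (j ℤ.- o) ≡⟨ cf-pad ∣ o′ ℤ.- o ∣ l (j ℤ.- o) ⟩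
    cf l ((j ℤ.- o) ℤ.- + ∣ o′ ℤ.- o ∣)          ≡⟨ ≡.cong (λ t → cf l ((j ℤ.- o) ℤ.- t)) (ℤP.0≤i⇒+∣i∣≡i (ℤP.i≤j⇒0≤j-i o≤o′)) ⟩
    cf l ((j ℤ.- o) ℤ.- (o′ ℤ.- o))              ≡⟨ ≡.cong (cf l) (cancel j o o′) ⟩
    cf l (j ℤ.- o′)                              ≡⟨ ≡.sym (coeff-cf o′ l j) ⟩
    coeff (mkL o′ l) j                           ∎
    where
    cancel : ∀ j o o′ → (j ℤ.- o) ℤ.- (o′ ℤ.- o) ≡ j ℤ.- o′
    cancel = ℤRing.solve-∀

  coeff-+L : ∀ p q j → coeff (p +L q) j ≈ coeff p j + coeff q j
  coeff-+L p q j = trans (reflexive (coeff-cf o _ j))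
    (trans (cf-add (shiftTo o p) (shiftTo o q) (j ℤ.- o))
      (+-cong (shiftTo-cf o p j (ℤP.i⊓j≤i (off p) (off q))) (shiftTo-cf o q j (ℤP.i⊓j≤j (off p) (off q)))))
    where o = off p ⊓ off q

  coeff-sum4 : ∀ p q r s j → coeff (((p +L q) +L r) +L s) j ≈ ((coeff p j + coeff q j) + coeff r j) + coeff s j
  coeff-sum4 p q r s j = trans (coeff-+L _ s j) (+-congʳ (trans (coeff-+L _ r j) (+-congʳ (coeff-+L p q j))))

  coeff-N : ∀ {k} (s : Vec Carrier k) j → coeff (N s) j ≡ cf (norm (Vec.toList s)) (j ℤ.+ + (k ∸ 1))
  coeff-N {k} s j = ≡.trans (coeff-cf _ (norm (Vec.toList s)) j)
    (≡.trans (≡.cong (λ t → cf (norm (Vec.toList s)) (j ℤ.- (+ 0 ℤ.+ ℤ.- (+ 0 ℤ.+ + (t ∸ 1))))) (length-toList s))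
             (≡.cong (cf (norm (Vec.toList s))) (offset j (+ (k ∸ 1)))))
    where
    offset : ∀ j x → j ℤ.- (+ 0 ℤ.+ ℤ.- (+ 0 ℤ.+ x)) ≡ j ℤ.+ x
    offset = ℤRing.solve-∀

  coeff-const : ∀ K j → coeff (constL K) j ≡ cf (fromℕR K ∷ []) j
  coeff-const K j = ≡.trans (coeff-cf (+ 0) _ j) (≡.cong (cf (fromℕR K ∷ [])) (ℤP.+-identityʳ j))

  X^-as-list : ∀ d → X ^ d ≋ replicate d 0# ++ 1# ∷ []
  X^-as-list zero = ℙ.refl
  X^-as-list (suc d) = ℙ.trans (X-mul (X ^ d)) (shift-cong (X^-as-list d))

  monomial-nth : ∀ K d i → nth (cst K ⊛ X ^ d) i ≈ cf (K ∷ []) (+ i ℤ.- + d)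
  monomial-nth K d i = trans (nth-mul-cons K [] (X ^ d) i) (trans (+-congˡ (tail-zero i)) (trans (+-identityʳ _)
    (trans (*-congˡ (at (X^-as-list d) i)) (trans (*-congˡ (reflexive (cf-pad d (1# ∷ []) (+ i)))) (scaled-unit (+ i ℤ.- + d))))))
    where
    tail-zero : ∀ i → nth (shift ([] ⊛ X ^ d)) i ≈ 0#
    tail-zero zero = refl
    tail-zero (suc i) = refl
    scaled-unit : ∀ z → K * cf (1# ∷ []) z ≈ cf (K ∷ []) z
    scaled-unit (+ zero) = *-identityʳ K
    scaled-unit (+ suc k) = zeroʳ K
    scaled-unit -[1+ k ] = zeroʳ K

  cf-monomial : ∀ (S : List Carrier) K d → S ≋ cst K ⊛ X ^ d → ∀ j → cf S (j ℤ.+ + d) ≈ cf (K ∷ []) j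
  cf-monomial S K d e j with j ℤ.+ + d in eq
  ... | + i = trans (at e i) (trans (monomial-nth K d i) (reflexive (≡.cong (cf (K ∷ [])) (≡.trans (≡.cong (ℤ._- + d) (≡.sym eq)) (cancel j (+ d))))))
    where
    cancel : ∀ j x → (j ℤ.+ x) ℤ.- x ≡ j
    cancel = ℤRing.solve-∀
  ... | -[1+ k ] = sym (trans (reflexive (≡.cong (cf (K ∷ [])) (≡.trans (≡.sym (cancel j (+ d))) (≡.cong (ℤ._- + d) eq))))
                              (reflexive (negative d)))
    where
    cancel : ∀ j x → (j ℤ.+ x) ℤ.- x ≡ j
    cancel = ℤRing.solve-∀
    negative : ∀ d → cf (K ∷ []) (-[1+ k ] ℤ.- + d) ≡ 0#
    negative zero = ≡.refl
    negative (suc d) = ≡.refl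

  index-long : ∀ k i → (+ i ℤ.- + suc k) ℤ.+ + suc k ≡ + i
  index-long k i = cancel (+ i) (+ suc k)
    where
    cancel : ∀ a b → (a ℤ.- b) ℤ.+ b ≡ a
    cancel = ℤRing.solve-∀

  index-short : ∀ k i (S : List Carrier) → cf S ((+ i ℤ.- + suc k) ℤ.+ + k) ≡ nth (shift S) i
  index-short k i S = ≡.trans (≡.cong (cf S) (≡.trans (cancel (+ i) (+ k)) (ℤP.m-n≡m⊖n i 1))) (predecessor i)
    where
    cancel : ∀ a b → (a ℤ.- (ℤ.+ 1 ℤ.+ b)) ℤ.+ b ≡ a ℤ.- ℤ.+ 1
    cancel = ℤRing.solve-∀
    predecessor : ∀ i → cf S (i ℤ.⊖ 1) ≡ nth (shift S) i
    predecessor zero = ≡.refl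
    predecessor (suc i) = ≡.refl

  normsFromLaurent : ∀ k (p q : Vec Carrier (suc (suc k))) (u v : Vec Carrier (suc k)) K →
    (∀ j → ((coeff (N p) j + coeff (N q) j) + coeff (N u) j) + coeff (N v) j ≈ coeff (constL K) j) →
    norm (Vec.toList p) ⊕ norm (Vec.toList q) ⊕ X ⊛ (norm (Vec.toList u) ⊕ norm (Vec.toList v)) ≋ cst (fromℕR K) ⊛ X ^ suc k
  normsFromLaurent k p q u v K H = mk≋ λ i →
    let j = + i ℤ.- + suc k in begin
    nth (P ⊕ Q ⊕ X ⊛ (U ⊕ V)) i
      ≈⟨ trans (nth-add (P ⊕ Q) _ i) (+-cong (nth-add P Q i) (trans (at (X-mul (U ⊕ V)) i) (nth-shift-add U V i))) ⟩
    (nth P i + nth Q i) + (nth (shift U) i + nth (shift V) i)   ≈⟨ sym (+-assoc _ _ _) ⟩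
    ((nth P i + nth Q i) + nth (shift U) i) + nth (shift V) i   ≈⟨ sym (+-cong (+-cong (+-cong (long p i) (long q i)) (short u i)) (short v i)) ⟩
    ((coeff (N p) j + coeff (N q) j) + coeff (N u) j) + coeff (N v) j ≈⟨ H j ⟩
    coeff (constL K) j                                         ≈⟨ reflexive (coeff-const K j) ⟩
    cf (fromℕR K ∷ []) j                                       ≈⟨ sym (monomial-nth (fromℕR K) (suc k) i) ⟩
    nth (cst (fromℕR K) ⊛ X ^ suc k) i                         ∎
    where
    P = norm (Vec.toList p)
    Q = norm (Vec.toList q)
    U = norm (Vec.toList u)
    V = norm (Vec.toList v)
    long : ∀ (s : Vec Carrier (suc (suc k))) i → coeff (N s) (+ i ℤ.- + suc k) ≈ nth (norm (Vec.toList s)) i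
    long s i = reflexive (≡.trans (coeff-N s (+ i ℤ.- + suc k)) (≡.cong (cf (norm (Vec.toList s))) (index-long k i)))
    short : ∀ (s : Vec Carrier (suc k)) i → coeff (N s) (+ i ℤ.- + suc k) ≈ nth (shift (norm (Vec.toList s))) i
    short s i = reflexive (≡.trans (coeff-N s (+ i ℤ.- + suc k)) (index-short k i (norm (Vec.toList s))))

  -- the hypotheses of the theorem list the sequences as (a,b,c,d) and as (e,f,g,h)
  normsFromSum : ∀ k (p q : Vec Carrier (suc (suc k))) (u v : Vec Carrier (suc k)) K →
    (((N p +L N q) +L N u) +L N v) ≈L constL K →
    norm (Vec.toList p) ⊕ norm (Vec.toList q) ⊕ X ⊛ (norm (Vec.toList u) ⊕ norm (Vec.toList v)) ≋ cst (fromℕR K) ⊛ X ^ suc k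
  normsFromSum k p q u v K H = normsFromLaurent k p q u v K λ j → trans (sym (coeff-sum4 (N p) (N q) (N u) (N v) j)) (H j)

  normsFromRotatedSum : ∀ k (u : Vec Carrier (suc k)) (p q : Vec Carrier (suc (suc k))) (v : Vec Carrier (suc k)) K →
    (((N u +L N p) +L N q) +L N v) ≈L constL K →
    norm (Vec.toList p) ⊕ norm (Vec.toList q) ⊕ X ⊛ (norm (Vec.toList u) ⊕ norm (Vec.toList v)) ≋ cst (fromℕR K) ⊛ X ^ suc k
  normsFromRotatedSum k u p q v K H = normsFromLaurent k p q u v K λ j →
    trans (+-congʳ (trans (+-comm _ _) (sym (+-assoc _ _ _)))) (trans (sym (coeff-sum4 (N u) (N p) (N q) (N v) j)) (H j))

  laurentFromNorms : ∀ k K (q r s u : Vec Carrier k) →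
    norm (Vec.toList q) ⊕ norm (Vec.toList r) ⊕ norm (Vec.toList s) ⊕ norm (Vec.toList u) ≋ cst (fromℕR K) ⊛ X ^ (k ∸ 1) →
    (((N q +L N r) +L N s) +L N u) ≈L constL K
  laurentFromNorms k K q r s u e j = begin
    coeff (((N q +L N r) +L N s) +L N u) j                              ≈⟨ coeff-sum4 (N q) (N r) (N s) (N u) j ⟩
    ((coeff (N q) j + coeff (N r) j) + coeff (N s) j) + coeff (N u) j
      ≈⟨ +-cong (+-cong (+-cong (reflexive (coeff-N q j)) (reflexive (coeff-N r j))) (reflexive (coeff-N s j))) (reflexive (coeff-N u j)) ⟩
    ((cf Q z + cf R′ z) + cf S z) + cf U z
      ≈⟨ sym (trans (cf-add _ U z) (+-congʳ (trans (cf-add _ S z) (+-congʳ (cf-add Q R′ z))))) ⟩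
    cf (Q ⊕ R′ ⊕ S ⊕ U) z                                              ≈⟨ cf-monomial _ (fromℕR K) (k ∸ 1) e j ⟩
    cf (fromℕR K ∷ []) j                                                ≈⟨ sym (reflexive (coeff-const K j)) ⟩
    coeff (constL K) j                                                  ∎
    where
    z = j ℤ.+ + (k ∸ 1)
    Q = norm (Vec.toList q)
    R′ = norm (Vec.toList r)
    S = norm (Vec.toList s)
    U = norm (Vec.toList u)

module ProductTheorem {c ℓ t : Level} (R : CommutativeRing c ℓ)
    (⋆ : CommutativeRing.Carrier R → CommutativeRing.Carrier R)
    (isInv : IsInvolutiveAutomorphism R ⋆)
    (T : CommutativeRing.Carrier R → Set t) (adm : IsAdmissibleSubset R ⋆ T) where
  open CommutativeRing R
  open LaurentPoly R ⋆ using (N; constL; _+L_; _≈L_; fromℕR)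
  open ProductConstruction R ⋆ isInv
  open NormProduct R[X] using (normProduct)
  open LaurentDictionary R ⋆ using (laurentFromNorms)
  open IsAdmissibleSubset adm
  open RingProperties ring using (-1*x≈-x)
  open import Algebra.Properties.Semiring.Mult semiring using (×1-homo-*) renaming (_×_ to _×ᴿ_)

  T-scal : ∀ {y} l → T y → ListAll.All T l → ListAll.All T (scal y l)
  T-scal l ty al = map⁺ (ListAll.map (mult-closed ty) al)

  T-neg : ∀ l → ListAll.All T l → ListAll.All T (neg l)
  T-neg l al = map⁺ (ListAll.map (λ tx → respects (-1*x≈-x _) (mult-closed minus-one tx)) al)

  T-bar : ∀ l → ListAll.All T l → ListAll.All T (bar l)
  T-bar l al = All-reverse (map⁺ (ListAll.map star-closed al))

  T-product : ∀ {Y00 X00 Y01 X01 Y10 X10 Y11 X11} →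
    ListAll.All T Y00 → ListAll.All T X00 → ListAll.All T Y01 → ListAll.All T X01 →
    ListAll.All T Y10 → ListAll.All T X10 → ListAll.All T Y11 → ListAll.All T X11 →
    ListAll.All T (product Y00 X00 Y01 X01 Y10 X10 Y11 X11)
  T-product {X00 = X00} {X01 = X01} {X10 = X10} {X11 = X11} y00 x00 y01 x01 y10 x10 y11 x11 =
    concat⁺ (All-interleave (All-zipWith (row X00 X01) (λ ty ty′ → All-interleave (T-scal X00 ty x00) (T-scal X01 ty′ x01)) y00 y01)
                            (All-zipWith (row X10 X11) (λ ty ty′ → All-interleave (T-scal X10 ty x10) (T-scal X11 ty′ x11)) y10 y11))

  fromℕR-* : ∀ a b → fromℕR (a ℕ.* b) ≈ fromℕR a * fromℕR b
  fromℕR-* a b = trans (reflexive (as-multiple (a ℕ.* b)))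
    (trans (×1-homo-* a b) (sym (*-cong (reflexive (as-multiple a)) (reflexive (as-multiple b)))))
    where
    as-multiple : ∀ k → fromℕR k ≡ k ×ᴿ 1#
    as-multiple zero = ≡.refl
    as-multiple (suc k) = ≡.cong (λ x → 1# + x) (as-multiple k)

  substitute-norms : ∀ p q u v V K k → norm p ⊕ norm q ⊕ X ⊛ (norm u ⊕ norm v) ≋ cst K ⊛ X ^ k →
    compose p V ⊛ compose (bar p) V ⊕ compose q V ⊛ compose (bar q) V
      ⊕ V ⊛ (compose u V ⊛ compose (bar u) V ⊕ compose v V ⊛ compose (bar v) V) ≋ cst K ⊛ V ^ k
  substitute-norms p q u v V K k e = ℙ.trans (ℙ.sym composed) (ℙ.trans (compose-cong V e)
    (ℙ.trans (compose-mul (cst K) (X ^ k) V) (mul-cong (compose-cst K V) (compose-pow k V))))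
    where
    sum-of-norms : ∀ p q → compose (norm p ⊕ norm q) V ≋ compose p V ⊛ compose (bar p) V ⊕ compose q V ⊛ compose (bar q) V
    sum-of-norms p q = ℙ.trans (compose-add (norm p) (norm q) V) (add-cong (compose-mul p (bar p) V) (compose-mul q (bar q) V))
    composed = ℙ.trans (compose-add (norm p ⊕ norm q) (X ⊛ (norm u ⊕ norm v)) V) (add-cong (sum-of-norms p q)
      (ℙ.trans (compose-mul X (norm u ⊕ norm v) V) (mul-cong (compose-X-at V) (sum-of-norms u v))))

  block-cong : ∀ w {y00 y00′ x00 x00′ y01 y01′ x01 x01′ y10 y10′ x10 x10′ y11 y11′ x11 x11′} →
    y00 ≋ y00′ → x00 ≋ x00′ → y01 ≋ y01′ → x01 ≋ x01′ → y10 ≋ y10′ → x10 ≋ x10′ → y11 ≋ y11′ → x11 ≋ x11′ →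
    block X w y00 x00 y01 x01 y10 x10 y11 x11 ≋ block X w y00′ x00′ y01′ x01′ y10′ x10′ y11′ x11′
  block-cong w e00 f00 e01 f01 e10 f10 e11 f11 =
    add-cong (add-cong (mul-cong e00 f00) (mul-cong e01 (⊛-congˡ X f01)))
             (⊛-congˡ w (add-cong (mul-cong e10 f10) (mul-cong e11 (⊛-congˡ X f11))))

  HallQuadruple : ℕ → ℕ → Set (c ⊔ ℓ ⊔ t)
  HallQuadruple k K =
    Σ[ q ∈ Vec Carrier k ] Σ[ r ∈ Vec Carrier k ] Σ[ s ∈ Vec Carrier k ] Σ[ u ∈ Vec Carrier k ]
      (All T q × All T r × All T s × All T u × (((N q +L N r) +L N s) +L N u) ≈L constL K)

  quadrupleFromLists : ∀ k K (q r s u : List Carrier) →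
    length q ≡ k → length r ≡ k → length s ≡ k → length u ≡ k →
    ListAll.All T q → ListAll.All T r → ListAll.All T s → ListAll.All T u →
    norm q ⊕ norm r ⊕ norm s ⊕ norm u ≋ cst (fromℕR K) ⊛ X ^ (k ∸ 1) → HallQuadruple k K
  quadrupleFromLists k K q r s u lq lr ls lu Tq Tr Ts Tu e
    with asVec q lq | asVec r lr | asVec s ls | asVec u lu
  ... | q′ , ≡.refl | r′ , ≡.refl | s′ , ≡.refl | u′ , ≡.refl =
    q′ , r′ , s′ , u′ , VecAll.toList⁻ Tq , VecAll.toList⁻ Tr , VecAll.toList⁻ Ts , VecAll.toList⁻ Tu ,
    laurentFromNorms k K q′ r′ s′ u′ e

  module Construction (m n : ℕ) (A B C D F G E H : List Carrier)
      (lA : length A ≡ suc n) (lB : length B ≡ suc n) (lC : length C ≡ n) (lD : length D ≡ n)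
      (lF : length F ≡ suc m) (lG : length G ≡ suc m) (lE : length E ≡ m) (lH : length H ≡ m) where

    q₁ q₂ q₃ q₄ : List Carrier
    q₁ = product F A (bar G) (neg C) (bar E) (neg B) H (neg (bar D))
    q₂ = product (bar F) B (bar G) (neg D) E A H (bar C)
    q₃ = product G A (bar F) C H (neg (bar B)) (bar E) D
    q₄ = product G B F D H (bar A) E (neg C)

    private
      lbar : ∀ {k} l → length l ≡ k → length (bar l) ≡ k
      lbar l e = ≡.trans (length-bar l) e
      lneg : ∀ {k} l → length l ≡ k → length (neg l) ≡ k
      lneg l e = ≡.trans (length-map -_ l) e

    shape₁ : Shape m n F A (bar G) (neg C) (bar E) (neg B) H (neg (bar D))
    shape₁ = record { len-Y00 = lF ; len-Y01 = lbar G lG ; len-Y10 = lbar E lE ; len-Y11 = lH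
                    ; len-X00 = lA ; len-X01 = lneg C lC ; len-X10 = lneg B lB ; len-X11 = lneg (bar D) (lbar D lD) }
    shape₂ : Shape m n (bar F) B (bar G) (neg D) E A H (bar C)
    shape₂ = record { len-Y00 = lbar F lF ; len-Y01 = lbar G lG ; len-Y10 = lE ; len-Y11 = lH
                    ; len-X00 = lB ; len-X01 = lneg D lD ; len-X10 = lA ; len-X11 = lbar C lC }
    shape₃ : Shape m n G A (bar F) C H (neg (bar B)) (bar E) D
    shape₃ = record { len-Y00 = lG ; len-Y01 = lbar F lF ; len-Y10 = lH ; len-Y11 = lbar E lE
                    ; len-X00 = lA ; len-X01 = lC ; len-X10 = lneg (bar B) (lbar B lB) ; len-X11 = lD }
    shape₄ : Shape m n G B F D H (bar A) E (neg C)
    shape₄ = record { len-Y00 = lG ; len-Y01 = lF ; len-Y10 = lH ; len-Y11 = lE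
                    ; len-X00 = lB ; len-X01 = lD ; len-X10 = lbar A lA ; len-X11 = lneg C lC }

    L : ℕ
    L = (2 ℕ.* m ℕ.+ 1) ℕ.* (2 ℕ.* n ℕ.+ 1)

    length-q : ∀ {Y00 X00 Y01 X01 Y10 X10 Y11 X11} → Shape m n Y00 X00 Y01 X01 Y10 X10 Y11 X11 →
      length (product Y00 X00 Y01 X01 Y10 X10 Y11 X11) ≡ L
    length-q shape = ≡.trans (ProductPoly.product-length shape) (dimensions m n)
      where
      dimensions : ∀ m n → (suc m ℕ.+ m) ℕ.* (suc n ℕ.+ n) ≡ (2 ℕ.* m ℕ.+ 1) ℕ.* (2 ℕ.* n ℕ.+ 1)
      dimensions = ℕRing.solve-∀

    W : List Carrier
    W = X ^ (suc n ℕ.+ n)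

    _∘W² : List Carrier → List Carrier
    l ∘W² = compose l (W ⊛ W)

    ν : List Carrier
    ν = ℙ.- ℙ.1#

    private
      neg∘X² : ∀ l → neg l ∘X² ≋ ν ⊛ (l ∘X²)
      neg∘X² l = compose-neg l X²
      bar-bar∘X² : ∀ l → bar (bar l) ∘X² ≋ l ∘X²
      bar-bar∘X² l = compose-cong X² (bar-bar l)
      bar-neg∘X² : ∀ l → bar (neg l) ∘X² ≋ ν ⊛ (bar l ∘X²)
      bar-neg∘X² l = ℙ.trans (compose-cong X² (bar-neg l)) (neg∘X² (bar l))
      bar-neg-bar∘X² : ∀ l → bar (neg (bar l)) ∘X² ≋ ν ⊛ (l ∘X²)
      bar-neg-bar∘X² l = ℙ.trans (bar-neg∘X² (bar l)) (⊛-congˡ ν (bar-bar∘X² l))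
      bar-bar∘W² : ∀ l → bar (bar l) ∘W² ≋ l ∘W²
      bar-bar∘W² l = compose-cong (W ⊛ W) (bar-bar l)

    H₁ H₂ : List Carrier
    H₁ = A ∘X² ⊛ (bar A ∘X²) ⊕ B ∘X² ⊛ (bar B ∘X²) ⊕ X² ⊛ (C ∘X² ⊛ (bar C ∘X²) ⊕ D ∘X² ⊛ (bar D ∘X²))
    H₂ = F ∘W² ⊛ (bar F ∘W²) ⊕ G ∘W² ⊛ (bar G ∘W²) ⊕ (W ⊛ W) ⊛ (E ∘W² ⊛ (bar E ∘W²) ⊕ H ∘W² ⊛ (bar H ∘W²))

    -- Each norm qᵢ·q̄ᵢ is a product of two blocks (product-poly, bar-product-poly);
    -- after pulling out the signs and cancelling double bars these are exactly
    -- the blocks of normProduct, so the four norms add up to H₁ H₂.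
    norms-sum : norm q₁ ⊕ norm q₂ ⊕ norm q₃ ⊕ norm q₄ ≋ H₁ ⊛ H₂
    norms-sum = ℙ.trans
      (add-cong (add-cong (add-cong
        (mul-cong (ℙ.trans (ProductPoly.product-poly shape₁)
                    (block-cong W (r (F ∘W²)) (r (A ∘X²)) (r (bar G ∘W²)) (neg∘X² C) (r (bar E ∘W²)) (neg∘X² B) (r (H ∘W²)) (neg∘X² (bar D))))
                  (ℙ.trans (ProductPoly.bar-product-poly shape₁)
                    (block-cong W (r (bar F ∘W²)) (r (bar A ∘X²)) (bar-bar∘W² G) (bar-neg∘X² C) (bar-bar∘W² E) (bar-neg∘X² B) (r (bar H ∘W²)) (bar-neg-bar∘X² D))))
        (mul-cong (ℙ.trans (ProductPoly.product-poly shape₂)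
                    (block-cong W (r (bar F ∘W²)) (r (B ∘X²)) (r (bar G ∘W²)) (neg∘X² D) (r (E ∘W²)) (r (A ∘X²)) (r (H ∘W²)) (r (bar C ∘X²))))
                  (ℙ.trans (ProductPoly.bar-product-poly shape₂)
                    (block-cong W (bar-bar∘W² F) (r (bar B ∘X²)) (bar-bar∘W² G) (bar-neg∘X² D) (r (bar E ∘W²)) (r (bar A ∘X²)) (r (bar H ∘W²)) (bar-bar∘X² C)))))
        (mul-cong (ℙ.trans (ProductPoly.product-poly shape₃)
                    (block-cong W (r (G ∘W²)) (r (A ∘X²)) (r (bar F ∘W²)) (r (C ∘X²)) (r (H ∘W²)) (neg∘X² (bar B)) (r (bar E ∘W²)) (r (D ∘X²))))
                  (ℙ.trans (ProductPoly.bar-product-poly shape₃)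
                    (block-cong W (r (bar G ∘W²)) (r (bar A ∘X²)) (bar-bar∘W² F) (r (bar C ∘X²)) (r (bar H ∘W²)) (bar-neg-bar∘X² B) (bar-bar∘W² E) (r (bar D ∘X²))))))
        (mul-cong (ℙ.trans (ProductPoly.product-poly shape₄)
                    (block-cong W (r (G ∘W²)) (r (B ∘X²)) (r (F ∘W²)) (r (D ∘X²)) (r (H ∘W²)) (r (bar A ∘X²)) (r (E ∘W²)) (neg∘X² C)))
                  (ℙ.trans (ProductPoly.bar-product-poly shape₄)
                    (block-cong W (r (bar G ∘W²)) (r (bar B ∘X²)) (r (bar F ∘W²)) (r (bar D ∘X²)) (r (bar H ∘W²)) (bar-bar∘X² A) (r (bar E ∘W²)) (bar-neg∘X² C)))))
      (normProduct (A ∘X²) (bar A ∘X²) (B ∘X²) (bar B ∘X²) (C ∘X²) (bar C ∘X²) (D ∘X²) (bar D ∘X²)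
                   (F ∘W²) (bar F ∘W²) (G ∘W²) (bar G ∘W²) (E ∘W²) (bar E ∘W²) (H ∘W²) (bar H ∘W²) X W)
      where
      r : ∀ p → p ≋ p
      r p = ℙ.refl

    K : ℕ
    K = 4 ℕ.* (2 ℕ.* m ℕ.+ 1) ℕ.* (2 ℕ.* n ℕ.+ 1)

    norms-q : norm A ⊕ norm B ⊕ X ⊛ (norm C ⊕ norm D) ≋ cst (fromℕR (2 ℕ.* (2 ℕ.* n ℕ.+ 1))) ⊛ X ^ n →
      norm F ⊕ norm G ⊕ X ⊛ (norm E ⊕ norm H) ≋ cst (fromℕR (2 ℕ.* (2 ℕ.* m ℕ.+ 1))) ⊛ X ^ m →
      norm q₁ ⊕ norm q₂ ⊕ norm q₃ ⊕ norm q₄ ≋ cst (fromℕR K) ⊛ X ^ (L ∸ 1)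
    norms-q hyp₁ hyp₂ = begin
      norm q₁ ⊕ norm q₂ ⊕ norm q₃ ⊕ norm q₄         ≈⟨ norms-sum ⟩
      H₁ ⊛ H₂                                       ≈⟨ mul-cong (substitute-norms A B C D X² K₁ n hyp₁) (substitute-norms F G E H (W ⊛ W) K₂ m hyp₂) ⟩
      (cst K₁ ⊛ X² ^ n) ⊛ (cst K₂ ⊛ (W ⊛ W) ^ m)    ≈⟨ interchange (cst K₁) (X² ^ n) (cst K₂) ((W ⊛ W) ^ m) ⟩
      (cst K₁ ⊛ cst K₂) ⊛ (X² ^ n ⊛ (W ⊛ W) ^ m)    ≈⟨ mul-cong (ℙ.trans (ℙ.sym (cst-mul K₁ K₂)) (cst-cong constant)) powers ⟩
      cst (fromℕR K) ⊛ X ^ (2 ℕ.* n ℕ.+ N′ ℕ.* (2 ℕ.* m)) ≡⟨ ≡.cong (λ k → cst (fromℕR K) ⊛ X ^ k) degree ⟩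
      cst (fromℕR K) ⊛ X ^ (L ∸ 1)                  ∎
      where
      open SetoidReasoning ℙ.setoid
      open import Algebra.Properties.CommutativeSemigroup ℙ.*-commutativeSemigroup using (interchange)
      N′ : ℕ
      N′ = suc n ℕ.+ n
      K₁ K₂ : Carrier
      K₁ = fromℕR (2 ℕ.* (2 ℕ.* n ℕ.+ 1))
      K₂ = fromℕR (2 ℕ.* (2 ℕ.* m ℕ.+ 1))
      constant : K₁ * K₂ ≈ fromℕR K
      constant = trans (sym (fromℕR-* (2 ℕ.* (2 ℕ.* n ℕ.+ 1)) (2 ℕ.* (2 ℕ.* m ℕ.+ 1)))) (reflexive (≡.cong fromℕR (product-of-constants m n)))
        where
        product-of-constants : ∀ m n → 2 ℕ.* (2 ℕ.* n ℕ.+ 1) ℕ.* (2 ℕ.* (2 ℕ.* m ℕ.+ 1)) ≡ 4 ℕ.* (2 ℕ.* m ℕ.+ 1) ℕ.* (2 ℕ.* n ℕ.+ 1)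
        product-of-constants = ℕRing.solve-∀
      powers : X² ^ n ⊛ (W ⊛ W) ^ m ≋ X ^ (2 ℕ.* n ℕ.+ N′ ℕ.* (2 ℕ.* m))
      powers = ℙ.trans (mul-cong (pow-square X n) (ℙ.trans (pow-square W m) (^-assocʳ X N′ (2 ℕ.* m))))
                       (ℙ.sym (^-homo-* X (2 ℕ.* n) (N′ ℕ.* (2 ℕ.* m))))
      degree : 2 ℕ.* n ℕ.+ N′ ℕ.* (2 ℕ.* m) ≡ L ∸ 1
      degree = ≡.cong (_∸ 1) (≡.sym (total m n))
        where
        total : ∀ m n → (2 ℕ.* m ℕ.+ 1) ℕ.* (2 ℕ.* n ℕ.+ 1) ≡ suc (2 ℕ.* n ℕ.+ (suc n ℕ.+ n) ℕ.* (2 ℕ.* m))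
        total = ℕRing.solve-∀

    hallQuadruple : ListAll.All T A → ListAll.All T B → ListAll.All T C → ListAll.All T D →
      ListAll.All T F → ListAll.All T G → ListAll.All T E → ListAll.All T H →
      norm A ⊕ norm B ⊕ X ⊛ (norm C ⊕ norm D) ≋ cst (fromℕR (2 ℕ.* (2 ℕ.* n ℕ.+ 1))) ⊛ X ^ n →
      norm F ⊕ norm G ⊕ X ⊛ (norm E ⊕ norm H) ≋ cst (fromℕR (2 ℕ.* (2 ℕ.* m ℕ.+ 1))) ⊛ X ^ m →
      HallQuadruple L K
    hallQuadruple tA tB tC tD tF tG tE tH hyp₁ hyp₂ =
      quadrupleFromLists L K q₁ q₂ q₃ q₄ (length-q shape₁) (length-q shape₂) (length-q shape₃) (length-q shape₄)
        (T-product tF tA (T-bar G tG) (T-neg C tC) (T-bar E tE) (T-neg B tB) tH (T-neg (bar D) (T-bar D tD)))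
        (T-product (T-bar F tF) tB (T-bar G tG) (T-neg D tD) tE tA tH (T-bar C tC))
        (T-product tG tA (T-bar F tF) tC tH (T-neg (bar B) (T-bar B tB)) (T-bar E tE) tD)
        (T-product tG tB tF tD tH (T-bar A tA) tE (T-neg C tC))
        (norms-q hyp₁ hyp₂)

theorem3p3 : ∀ {c ℓ t : Level} (R : CommutativeRing c ℓ)
  (⋆ : CommutativeRing.Carrier R → CommutativeRing.Carrier R)
  → IsInvolutiveAutomorphism R ⋆
  → (T : CommutativeRing.Carrier R → Set t) → IsAdmissibleSubset R ⋆ T
  → (m n : ℕ) → m ≥ 1 → n ≥ 1
  → (a b : Vec (CommutativeRing.Carrier R) (suc n))
  → (c d : Vec (CommutativeRing.Carrier R) n)
  → (f g : Vec (CommutativeRing.Carrier R) (suc m))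
  → (h e : Vec (CommutativeRing.Carrier R) m)
  → All T a → All T b → All T c → All T d
  → All T f → All T g → All T h → All T e
  → LaurentPoly._≈L_ R ⋆
      (LaurentPoly._+L_ R ⋆ (LaurentPoly._+L_ R ⋆ (LaurentPoly._+L_ R ⋆ (LaurentPoly.N R ⋆ a) (LaurentPoly.N R ⋆ b)) (LaurentPoly.N R ⋆ c)) (LaurentPoly.N R ⋆ d))
      (LaurentPoly.constL R ⋆ (2 ℕ.* (2 ℕ.* n ℕ.+ 1)))
  → LaurentPoly._≈L_ R ⋆
      (LaurentPoly._+L_ R ⋆ (LaurentPoly._+L_ R ⋆ (LaurentPoly._+L_ R ⋆ (LaurentPoly.N R ⋆ e) (LaurentPoly.N R ⋆ f)) (LaurentPoly.N R ⋆ g)) (LaurentPoly.N R ⋆ h))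
      (LaurentPoly.constL R ⋆ (2 ℕ.* (2 ℕ.* m ℕ.+ 1)))
  → Σ[ q ∈ Vec (CommutativeRing.Carrier R) ((2 ℕ.* m ℕ.+ 1) ℕ.* (2 ℕ.* n ℕ.+ 1)) ]
    Σ[ r ∈ Vec (CommutativeRing.Carrier R) ((2 ℕ.* m ℕ.+ 1) ℕ.* (2 ℕ.* n ℕ.+ 1)) ]
    Σ[ s ∈ Vec (CommutativeRing.Carrier R) ((2 ℕ.* m ℕ.+ 1) ℕ.* (2 ℕ.* n ℕ.+ 1)) ]
    Σ[ u ∈ Vec (CommutativeRing.Carrier R) ((2 ℕ.* m ℕ.+ 1) ℕ.* (2 ℕ.* n ℕ.+ 1)) ]
      (All T q × All T r × All T s × All T u
       × LaurentPoly._≈L_ R ⋆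
           (LaurentPoly._+L_ R ⋆ (LaurentPoly._+L_ R ⋆ (LaurentPoly._+L_ R ⋆ (LaurentPoly.N R ⋆ q) (LaurentPoly.N R ⋆ r)) (LaurentPoly.N R ⋆ s)) (LaurentPoly.N R ⋆ u))
           (LaurentPoly.constL R ⋆ (4 ℕ.* (2 ℕ.* m ℕ.+ 1) ℕ.* (2 ℕ.* n ℕ.+ 1))))
theorem3p3 R ⋆ isInv T adm (suc m′) (suc n′) _ _ a b c d f g h e Ta Tb Tc Td Tf Tg Th Te abcd-norms efgh-norms =
  hallQuadruple (toList⁺ Ta) (toList⁺ Tb) (toList⁺ Tc) (toList⁺ Td) (toList⁺ Tf) (toList⁺ Tg) (toList⁺ Te) (toList⁺ Th)
    (normsFromSum n′ a b c d (2 ℕ.* (2 ℕ.* suc n′ ℕ.+ 1)) abcd-norms)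
    (normsFromRotatedSum m′ e f g h (2 ℕ.* (2 ℕ.* suc m′ ℕ.+ 1)) efgh-norms)
  where
  open VecAll using (toList⁺)
  open LaurentDictionary R ⋆ using (normsFromSum; normsFromRotatedSum)
  open ProductTheorem R ⋆ isInv T adm
  open Construction (suc m′) (suc n′)
    (Vec.toList a) (Vec.toList b) (Vec.toList c) (Vec.toList d) (Vec.toList f) (Vec.toList g) (Vec.toList e) (Vec.toList h)
    (length-toList a) (length-toList b) (length-toList c) (length-toList d)
    (length-toList f) (length-toList g) (length-toList e) (length-toList h)
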